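{- Let $k\ge 3$, and let $b=b_1\cdots b_n$ be a binary string with $b_1=\dots=b_s=0$ and $b_{s+1}=1$ for some $s\ge k-1$. Let $c:\{1,\dots,n\}\to\mathbb{Z}$ and $\tau$ be the labeling and threshold produced by the construction described in the context. Then: (1) If $[i_1,i_2]$ and $[i_3,i_4]$ are $1$-intervals of $b$ with $i_2<i_3$, then $c(i)<c(j)$ for all $i\in[i_1,i_2]$, $j\in[i_3,i_4]$; and if $[i_5,i_6]$ is a non-trivial $1$-interval, then $c(i)=c(j)$ for all $i,j\in[i_5,i_6]$. (2) $c(i)=c(j)$ for all $i,j\in[1,s]$; if $[i_1,i_2]$ and $[i_3,i_4]$ are $0$-intervals of $b$ with $s<i_1$ and $i_2<i_3$, then $c(i)>c(j)$ for all $i\in[i_1,i_2]$, $j\in[i_3,i_4]$; and if $[i_5,i_6]$ is a non-trivial $0$-interval other than $[1,s]$, then $c(i)<c(j)$ for all $i,j\in[i_5,i_6]$ with $i<j$. Consequently, the label of every position $j$ with $b_j=1$ is larger than the label of every position $i$ with $b_i=0$.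
   Context: For a binary string $b=b_1\cdots b_n$ and $t\in\{0,1\}$, a $t$-interval is a maximal interval $[i_1,i_2]$ of consecutive positions with $b_j=t$ for all $i_1\le j\le i_2$ (so $b_{i_1-1}=b_{i_2+1}=1-t$ whenever these positions exist); it is trivial if $i_1=i_2$ and non-trivial otherwise. Construction of $(c,\tau)$: For $m\le n$ let $b^m=b_1\cdots b_m$. Start at $m=s+1$ with $c(i)=2$ for $1\le i\le s$, $c(s+1)=3$, and $\tau=2k$. Given the labeling $c'$ on $\{1,\dots,m\}$ and threshold $\tau'$ for $b^m$ ($s+1\le m<n$), define $c$ on $\{1,\dots,m+1\}$ and $\tau$ as follows. If $b_{m+1}=1$: $c(i)=c'(i)$ for $i\le m$, $c(m+1)=\tau'+1-\sum_{j\in L}c'(j)$, where $L$ is a set of $k-1$ positions $j\le m$ with $b_j=0$ having the $k-1$ smallest values of $c'$ among such positions, and $\tau=\tau'$. If $b_{m+1}=0$: $c(i)=2c'(i)$ for $i\le m$, and, writing $D=\{j\le m: b_j=1\}$: if $|D|\ge k-1$, $c(m+1)=2\tau'+1-2\sum_{j\in D'}c'(j)$ where $D'$ consists of the $k-1$ largest elements of $D$; if $|D|<k-1$, $c(m+1)=2\tau'+1-2\sum_{j\in D}c'(j)-2\sum_{j=1}^{k-1-|D|}c'(j)$; and $\tau=2\tau'+1$. Repeat until $m+1=n$; the final $c,\tau$ are the output. -}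

module Defs where

open import Data.Bool using (Bool; true; false; not)
open import Data.Nat as ℕ using (ℕ; zero; suc; _∸_)
open import Data.Integer as ℤ using (ℤ; +_; _+_; _-_; _*_; _<_; _>_)
open import Data.Integer.Properties using (≤-decTotalOrder)
open import Data.List using (List; []; _∷_; _++_; [_]; map; foldr; take; drop; length; replicate; foldl; zip; filter)
open import Data.Maybe using (Maybe; just; nothing)
open import Data.Product using (_×_; _,_; proj₁; proj₂)
open import Relation.Binary.PropositionalEquality using (_≡_)
open import Relation.Nullary using (¬_; yes; no)
import Data.List.Sort.InsertionSort as Sort
open Sort ≤-decTotalOrder using (sort)

sumℤ : List ℤ → ℤ
sumℤ = foldr _+_ (+ 0)

-- 1-indexed lookup in a list: position i (1 ≤ i ≤ length xs), nothing otherwise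
_‼_ : {A : Set} → List A → ℕ → Maybe A
[]       ‼ _             = nothing
(x ∷ xs) ‼ zero          = nothing
(x ∷ xs) ‼ suc zero      = just x
(x ∷ xs) ‼ suc (suc i)   = xs ‼ suc i

-- State of the construction after processing a prefix b^m:
-- the prefix bits, the labels c(1..m) (in order), and the threshold τ.
record State : Set where
  constructor st
  field
    bits   : List Bool
    labels : List ℤ
    thr    : ℤ
open State public

labelsWith : Bool → List Bool → List ℤ → List ℤ
labelsWith t []       _        = []
labelsWith t (_ ∷ _)  []       = []
labelsWith true  (true ∷ bs)  (c ∷ cs) = c ∷ labelsWith true bs cs
labelsWith true  (false ∷ bs) (c ∷ cs) = labelsWith true bs cs
labelsWith false (false ∷ bs) (c ∷ cs) = c ∷ labelsWith false bs cs
labelsWith false (true ∷ bs)  (c ∷ cs) = labelsWith false bs cs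

step : ℕ → State → Bool → State
step k (st bs cs τ) true =
  -- L: the k-1 zero positions with the smallest labels; its label sum is the
  -- sum of the k-1 smallest labels among zero positions
  st (bs ++ [ true ])
     (cs ++ [ τ + ℤ.1ℤ - sumℤ (take (k ∸ 1) (sort (labelsWith false bs cs))) ])
     τ
step k (st bs cs τ) false with ℕ._≤?_ (k ∸ 1) (length D)
  where D = labelsWith true bs cs
... | yes _ =
  -- D' : the k-1 largest one-positions (= last k-1 in position order)
  let D = labelsWith true bs cs in
  st (bs ++ [ false ])
     (map (λ x → + 2 * x) cs ++
        [ + 2 * τ + ℤ.1ℤ - + 2 * sumℤ (drop (length D ∸ (k ∸ 1)) D) ])
     (+ 2 * τ + ℤ.1ℤ)
... | no _ =
  let D = labelsWith true bs cs in
  st (bs ++ [ false ])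
     (map (λ x → + 2 * x) cs ++
        [ + 2 * τ + ℤ.1ℤ - + 2 * sumℤ D - + 2 * sumℤ (take ((k ∸ 1) ∸ length D) cs) ])
     (+ 2 * τ + ℤ.1ℤ)

initial : ℕ → ℕ → List Bool → State
initial k s b = st (take (suc s) b) (replicate s (+ 2) ++ [ + 3 ]) (+ (2 ℕ.* k))

construct : ℕ → ℕ → List Bool → State
construct k s b = foldl (step k) (initial k s b) (drop (suc s) b)

-- the label c(i) (1-indexed); default 0 outside 1..n (never used there)
label : ℕ → ℕ → List Bool → ℕ → ℤ
label k s b i with labels (construct k s b) ‼ i
... | just x  = x
... | nothing = + 0

threshold : ℕ → ℕ → List Bool → ℤ
threshold k s b = thr (construct k s b)

IsInterval : List Bool → Bool → ℕ → ℕ → Set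
IsInterval b t i₁ i₂ =
  (1 ℕ.≤ i₁) × (i₁ ℕ.≤ i₂) × (i₂ ℕ.≤ length b) ×
  (∀ j → i₁ ℕ.≤ j → j ℕ.≤ i₂ → b ‼ j ≡ just t) ×
  (1 ℕ.< i₁ → b ‼ (i₁ ∸ 1) ≡ just (not t)) ×
  (i₂ ℕ.< length b → b ‼ suc i₂ ≡ just (not t))

NonTrivial : ℕ → ℕ → Set
NonTrivial i₁ i₂ = ¬ (i₁ ≡ i₂)

-- Positions 1..s keep a common label z₀ throughout, and every step only
-- appends a position (a 0-step also doubles all earlier labels, which keeps
-- their order).  Let M = Σ_{j∈L} c(j), the sum of the k-1 smallest 0-labels,
-- so M ≤ (k-1)z₀, and T = Σ_{j∈D'} c(j).  A new 1 is labelled τ + 1 - M and a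
-- new 0 is labelled 2τ + 1 - 2T.  Each step preserves a few linear
-- inequalities: every 1-label o has z₀ < o, τ < o + T, o + (k-2)z₀ ≤ T and
-- o + M ≤ τ + 1; every 0-label z after s has z + (k-1)z₀ ≤ τ; the newest label
-- is exactly τ + 1 - M resp. τ - T.  From these, the order of a new label
-- against each earlier one follows from the order among the earlier labels,
-- so the statement of the lemma for every pair of positions is an invariant
-- of the construction.

module Submission where

open import Defs
open import Data.Bool using (Bool; true; false; not)
open import Data.Empty using (⊥; ⊥-elim)
open import Data.Integer as ℤ
  using (ℤ; +_; 0ℤ; 1ℤ; _+_; _-_; _*_) renaming (_≤_ to _≤ℤ_; _<_ to _<ℤ_)
import Data.Integer.Properties as ℤ
open import Algebra.Properties.CommutativeSemigroup ℤ.+-commutativeSemigroup using (x∙yz≈y∙xz)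
open import Data.Integer.Tactic.RingSolver using (solve-∀)
open import Data.List using (List; []; _∷_; _++_; [_]; map; take; drop; length; replicate; foldl)
import Data.List.Properties as List
open import Data.List.Membership.Propositional using (_∈_)
open import Data.List.Membership.Propositional.Properties using (∈-++⁺ʳ)
open import Data.List.Relation.Unary.Any using (here)
open import Data.List.Relation.Binary.Sublist.Propositional using (_⊆_; []; _∷_; _∷ʳ_; from∈; minimum)
open import Data.List.Relation.Binary.Sublist.Propositional.Properties using (length-mono-≤; ++⁺; ++⁺ʳ)
open import Data.List.Relation.Unary.All as All using (All; []; _∷_)
import Data.List.Relation.Unary.All.Properties as All
import Data.List.Relation.Unary.Linked as Linked
open import Data.List.Relation.Unary.Linked.Properties using (Linked⇒All)
open import Data.List.Relation.Unary.Sorted.TotalOrder ℤ.≤-totalOrder using (Sorted)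
open import Data.List.Sort.InsertionSort ℤ.≤-decTotalOrder using (sort)
open import Data.List.Sort.InsertionSort.Base ℤ.≤-decTotalOrder using (insert)
open import Data.List.Sort.InsertionSort.Properties ℤ.≤-decTotalOrder using (sort-↗)
open import Data.Maybe using (just; nothing; fromMaybe)
open import Data.Maybe.Properties using (just-injective)
open import Data.Nat as ℕ using (ℕ; zero; suc; _≤_; _<_; _∸_; z≤n; s≤s; _≤?_)
import Data.Nat.Properties as ℕ
import Data.Nat.Tactic.RingSolver as ℕ-Solver
open import Data.Product using (_×_; _,_; proj₁; proj₂; Σ; ∃-syntax)
open import Function using (_∘_; id)
open import Data.Sum using (inj₁; inj₂)
open import Relation.Binary.PropositionalEquality hiding ([_])
open import Relation.Nullary using (¬_; yes; no)
open import Relation.Binary.Definitions using (tri<; tri≈; tri>)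

private
  variable
    A : Set
    a : ℤ

_!_ : List ℤ → ℕ → ℤ
C ! i = fromMaybe 0ℤ (C ‼ i)

‼-just-not : ∀ {B : List Bool} {l t} → B ‼ l ≡ just t → B ‼ l ≡ just (not t) → ⊥
‼-just-not {t = true}  e e′ with trans (sym e) e′
... | ()
‼-just-not {t = false} e e′ with trans (sym e) e′
... | ()

‼-just⇒bounds : ∀ (xs : List A) i {x} → xs ‼ i ≡ just x → 1 ≤ i × i ≤ length xs
‼-just⇒bounds (_ ∷ _)  (suc zero)    _ = s≤s z≤n , s≤s z≤n
‼-just⇒bounds (_ ∷ xs) (suc (suc i)) e = s≤s z≤n , s≤s (proj₂ (‼-just⇒bounds xs (suc i) e))

‼-∷ʳ : ∀ (xs : List A) y i → i ≤ length xs → (xs ++ [ y ]) ‼ i ≡ xs ‼ i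
‼-∷ʳ []       y zero          _       = refl
‼-∷ʳ (_ ∷ _)  y zero          _       = refl
‼-∷ʳ (_ ∷ _)  y (suc zero)    _       = refl
‼-∷ʳ (_ ∷ xs) y (suc (suc i)) (s≤s h) = ‼-∷ʳ xs y (suc i) h

‼-∷ʳ-last : ∀ (xs : List A) y → (xs ++ [ y ]) ‼ suc (length xs) ≡ just y
‼-∷ʳ-last []       y = refl
‼-∷ʳ-last (_ ∷ xs) y = ‼-∷ʳ-last xs y

length-∷ʳ : ∀ (xs : List A) y → length (xs ++ [ y ]) ≡ suc (length xs)
length-∷ʳ []       y = refl
length-∷ʳ (_ ∷ xs) y = cong suc (length-∷ʳ xs y)

!-∷ʳ : ∀ C y i → i ≤ length C → (C ++ [ y ]) ! i ≡ C ! i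
!-∷ʳ C y i i≤C = cong (fromMaybe 0ℤ) (‼-∷ʳ C y i i≤C)

!-∷ʳ-last : ∀ C y → (C ++ [ y ]) ! suc (length C) ≡ y
!-∷ʳ-last C y = cong (fromMaybe 0ℤ) (‼-∷ʳ-last C y)

‼-last : ∀ (xs : List A) → 1 ≤ length xs → Σ A λ x → xs ‼ length xs ≡ just x
‼-last (x ∷ [])     _ = x , refl
‼-last (_ ∷ y ∷ xs) _ = ‼-last (y ∷ xs) (s≤s z≤n)

‼-replicate-++ : ∀ s (a : A) xs i → 1 ≤ i → i ≤ s → (replicate s a ++ xs) ‼ i ≡ just a
‼-replicate-++ (suc s)       a xs (suc zero)    _ _           = refl
‼-replicate-++ (suc (suc s)) a xs (suc (suc i)) _ (s≤s i≤1+s) =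
  ‼-replicate-++ (suc s) a xs (suc i) (s≤s z≤n) i≤1+s

‼-replicate-++-shift : ∀ s (a : A) xs i → (replicate s a ++ xs) ‼ (s ℕ.+ suc i) ≡ xs ‼ suc i
‼-replicate-++-shift zero          a xs i = refl
‼-replicate-++-shift (suc zero)    a xs i = refl
‼-replicate-++-shift (suc (suc s)) a xs i = ‼-replicate-++-shift (suc s) a xs i

length-replicate-++ : ∀ n (a : A) xs → length (replicate n a ++ xs) ≡ n ℕ.+ length xs
length-replicate-++ n a xs = trans (List.length-++ (replicate n a)) (cong (ℕ._+ length xs) (List.length-replicate n))

take-suc≡replicate-∷ʳ : ∀ n b → n < length b → (∀ i → 1 ≤ i → i ≤ n → b ‼ i ≡ just false) →
  b ‼ suc n ≡ just true → take (suc n) b ≡ replicate n false ++ [ true ]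
take-suc≡replicate-∷ʳ zero    (x ∷ b) _       _     one = cong [_] (just-injective one)
take-suc≡replicate-∷ʳ (suc n) (x ∷ b) (s≤s h) zeros one =
  cong₂ _∷_ (just-injective (zeros 1 (s≤s z≤n) (s≤s z≤n)))
    (take-suc≡replicate-∷ʳ n b h (λ { (suc i) _ (s≤s i≤n) → zeros (suc (suc i)) (s≤s z≤n) (s≤s (s≤s i≤n)) }) one)

!-map : ∀ (f : ℤ → ℤ) → f 0ℤ ≡ 0ℤ → ∀ C i → map f C ! i ≡ f (C ! i)
!-map f f0 []      i             = sym f0
!-map f f0 (_ ∷ _) zero          = sym f0
!-map f f0 (_ ∷ _) (suc zero)    = refl
!-map f f0 (_ ∷ C) (suc (suc i)) = !-map f f0 C (suc i)

labelsWith-∷ʳ : ∀ t b bs cs c → length bs ≡ length cs →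
  labelsWith t (bs ++ [ b ]) (cs ++ [ c ]) ≡ labelsWith t bs cs ++ labelsWith t [ b ] [ c ]
labelsWith-∷ʳ t     b []           []       c _ = refl
labelsWith-∷ʳ true  b (true ∷ bs)  (c′ ∷ cs) c e = cong (c′ ∷_) (labelsWith-∷ʳ true b bs cs c (ℕ.suc-injective e))
labelsWith-∷ʳ true  b (false ∷ bs) (_ ∷ cs)  c e = labelsWith-∷ʳ true b bs cs c (ℕ.suc-injective e)
labelsWith-∷ʳ false b (false ∷ bs) (c′ ∷ cs) c e = cong (c′ ∷_) (labelsWith-∷ʳ false b bs cs c (ℕ.suc-injective e))
labelsWith-∷ʳ false b (true ∷ bs)  (_ ∷ cs)  c e = labelsWith-∷ʳ false b bs cs c (ℕ.suc-injective e)

labelsWith-map : ∀ t bs cs (f : ℤ → ℤ) → labelsWith t bs (map f cs) ≡ map f (labelsWith t bs cs)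
labelsWith-map t     []           cs       f = refl
labelsWith-map t     (_ ∷ _)      []       f = refl
labelsWith-map true  (true ∷ bs)  (c ∷ cs) f = cong (f c ∷_) (labelsWith-map true bs cs f)
labelsWith-map true  (false ∷ bs) (_ ∷ cs) f = labelsWith-map true bs cs f
labelsWith-map false (false ∷ bs) (c ∷ cs) f = cong (f c ∷_) (labelsWith-map false bs cs f)
labelsWith-map false (true ∷ bs)  (_ ∷ cs) f = labelsWith-map false bs cs f

labelsWith-true-zeros++ : ∀ s a bs cs →
  labelsWith true (replicate s false ++ bs) (replicate s a ++ cs) ≡ labelsWith true bs cs
labelsWith-true-zeros++ zero    a bs cs = refl
labelsWith-true-zeros++ (suc s) a bs cs = labelsWith-true-zeros++ s a bs cs

labelsWith-false-zeros++ : ∀ s a bs cs →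
  labelsWith false (replicate s false ++ bs) (replicate s a ++ cs) ≡ replicate s a ++ labelsWith false bs cs
labelsWith-false-zeros++ zero    a bs cs = refl
labelsWith-false-zeros++ (suc s) a bs cs = cong (a ∷_) (labelsWith-false-zeros++ s a bs cs)

All-labelsWith : ∀ {P : ℤ → Set} t bs cs i → length bs ≡ length cs →
  All P (labelsWith t bs cs) → bs ‼ i ≡ just t → P (cs ! i)
All-labelsWith true  (true ∷ bs)  (c ∷ cs) (suc zero)    _ (p ∷ _)  _ = p
All-labelsWith false (false ∷ bs) (c ∷ cs) (suc zero)    _ (p ∷ _)  _ = p
All-labelsWith true  (true ∷ bs)  (c ∷ cs) (suc (suc i)) e (_ ∷ ps) b = All-labelsWith true  bs cs (suc i) (ℕ.suc-injective e) ps b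
All-labelsWith true  (false ∷ bs) (c ∷ cs) (suc (suc i)) e ps       b = All-labelsWith true  bs cs (suc i) (ℕ.suc-injective e) ps b
All-labelsWith false (false ∷ bs) (c ∷ cs) (suc (suc i)) e (_ ∷ ps) b = All-labelsWith false bs cs (suc i) (ℕ.suc-injective e) ps b
All-labelsWith false (true ∷ bs)  (c ∷ cs) (suc (suc i)) e ps       b = All-labelsWith false bs cs (suc i) (ℕ.suc-injective e) ps b

double : ℤ → ℤ
double x = + 2 * x

infixl 7 _·_
_·_ : ℕ → ℤ → ℤ
n · a = sumℤ (replicate n a)

sumℤ-++ : ∀ xs ys → sumℤ (xs ++ ys) ≡ sumℤ xs + sumℤ ys
sumℤ-++ []       ys = sym (ℤ.+-identityˡ _)
sumℤ-++ (x ∷ xs) ys = trans (cong (_+_ x) (sumℤ-++ xs ys)) (sym (ℤ.+-assoc x _ _))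

sumℤ-map-double : ∀ xs → sumℤ (map double xs) ≡ double (sumℤ xs)
sumℤ-map-double []       = refl
sumℤ-map-double (x ∷ xs) =
  trans (cong (_+_ (double x)) (sumℤ-map-double xs)) (sym (ℤ.*-distribˡ-+ (+ 2) x _))

·-+ : ∀ m n a → (m ℕ.+ n) · a ≡ m · a + n · a
·-+ zero    n a = sym (ℤ.+-identityˡ _)
·-+ (suc m) n a = trans (cong (_+_ a) (·-+ m n a)) (sym (ℤ.+-assoc a _ _))

·-double : ∀ n a → n · double a ≡ double (n · a)
·-double n a = trans (cong sumℤ (sym (List.map-replicate double n a))) (sumℤ-map-double (replicate n a))

·-pos : ∀ n m → n · (+ m) ≡ + (n ℕ.* m)
·-pos zero    m = refl
·-pos (suc n) m = cong (_+_ (+ m)) (·-pos n m)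

·≤sumℤ : ∀ L → All (a ≤ℤ_) L → length L · a ≤ℤ sumℤ L
·≤sumℤ []      []       = ℤ.≤-refl
·≤sumℤ (_ ∷ L) (p ∷ ps) = ℤ.+-mono-≤ p (·≤sumℤ L ps)

take-replicate : ∀ m n (a : A) → m ≤ n → take m (replicate n a) ≡ replicate m a
take-replicate zero    n       a _       = refl
take-replicate (suc m) (suc n) a (s≤s h) = cong (a ∷_) (take-replicate m n a h)

take-++ˡ : ∀ m (xs ys : List A) → m ≤ length xs → take m (xs ++ ys) ≡ take m xs
take-++ˡ zero    xs       ys _       = refl
take-++ˡ (suc m) (x ∷ xs) ys (s≤s h) = cong (x ∷_) (take-++ˡ m xs ys h)

drop-++ˡ : ∀ m (xs ys : List A) → m ≤ length xs → drop m (xs ++ ys) ≡ drop m xs ++ ys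
drop-++ˡ zero    xs       ys _       = refl
drop-++ˡ (suc m) (x ∷ xs) ys (s≤s h) = drop-++ˡ m xs ys h

-- The j smallest elements have the least sum among j-element sublists

sumℤ-take-∷-≤ : ∀ j x ws → All (x ≤ℤ_) ws → suc j ≤ length ws →
  sumℤ (take (suc j) (x ∷ ws)) ≤ℤ sumℤ (take (suc j) ws)
sumℤ-take-∷-≤ zero    x (w ∷ ws) (x≤w ∷ _)   _       = ℤ.+-monoˡ-≤ 0ℤ x≤w
sumℤ-take-∷-≤ (suc j) x (w ∷ ws) (x≤w ∷ x≤ws) (s≤s h) =
  subst (_≤ℤ w + sumℤ (take (suc j) ws)) (x∙yz≈y∙xz w x _)
    (ℤ.+-monoʳ-≤ w (sumℤ-take-∷-≤ j x ws x≤ws h))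

sumℤ-take-insert-≤ : ∀ x zs j → Sorted zs → j ≤ length zs →
  sumℤ (take j (insert x zs)) ≤ℤ sumℤ (take j zs)
sumℤ-take-insert-≤ x []       zero    _   _ = ℤ.≤-refl
sumℤ-take-insert-≤ x (y ∷ ys) zero    _   _ = ℤ.≤-refl
sumℤ-take-insert-≤ x (y ∷ ys) (suc j) srt h with x ℤ.≤? y
... | yes x≤y = sumℤ-take-∷-≤ j x (y ∷ ys) (Linked⇒All ℤ.≤-trans x≤y srt) h
... | no  _   = ℤ.+-monoʳ-≤ y (sumℤ-take-insert-≤ x ys j (Linked.tail srt) (ℕ.≤-pred h))

sumℤ-take-suc-insert-≤ : ∀ x zs j → sumℤ (take (suc j) (insert x zs)) ≤ℤ x + sumℤ (take j zs)
sumℤ-take-suc-insert-≤ x []       j = ℤ.≤-refl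
sumℤ-take-suc-insert-≤ x (y ∷ ys) j with x ℤ.≤? y
sumℤ-take-suc-insert-≤ x (y ∷ ys) j       | yes _ = ℤ.≤-refl
sumℤ-take-suc-insert-≤ x (y ∷ ys) zero    | no x≰y = ℤ.+-monoˡ-≤ 0ℤ (ℤ.<⇒≤ (ℤ.≰⇒> x≰y))
sumℤ-take-suc-insert-≤ x (y ∷ ys) (suc j) | no _ =
  subst (y + sumℤ (take (suc j) (insert x ys)) ≤ℤ_) (x∙yz≈y∙xz y x _)
    (ℤ.+-monoʳ-≤ y (sumℤ-take-suc-insert-≤ x ys j))

length-insert : ∀ x zs → length (insert x zs) ≡ suc (length zs)
length-insert x []       = refl
length-insert x (y ∷ ys) with x ℤ.≤? y
... | yes _ = refl
... | no  _ = cong suc (length-insert x ys)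

length-sort : ∀ xs → length (sort xs) ≡ length xs
length-sort []       = refl
length-sort (x ∷ xs) = trans (length-insert x (sort xs)) (cong suc (length-sort xs))

sumℤ-take-sort-≤ : ∀ {ys xs} → ys ⊆ xs → sumℤ (take (length ys) (sort xs)) ≤ℤ sumℤ ys
sumℤ-take-sort-≤ [] = ℤ.≤-refl
sumℤ-take-sort-≤ {ys} {x ∷ xs} (.x ∷ʳ ys⊆xs) =
  ℤ.≤-trans
    (sumℤ-take-insert-≤ x (sort xs) (length ys) (sort-↗ xs)
      (subst (length ys ≤_) (sym (length-sort xs)) (length-mono-≤ ys⊆xs)))
    (sumℤ-take-sort-≤ ys⊆xs)
sumℤ-take-sort-≤ {y ∷ ys} {x ∷ xs} (refl ∷ ys⊆xs) =
  ℤ.≤-trans (sumℤ-take-suc-insert-≤ x (sort xs) (length ys)) (ℤ.+-monoʳ-≤ x (sumℤ-take-sort-≤ ys⊆xs))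

replicate-⊆ : ∀ {j n} (a : A) → j ≤ n → replicate j a ⊆ replicate n a
replicate-⊆ {j = zero}              a _       = minimum (replicate _ a)
replicate-⊆ {j = suc j} {n = suc n} a (s≤s h) = refl ∷ replicate-⊆ a h

sumℤ-take-sort-replicate-++ : ∀ {j n} a Z → j ≤ n → sumℤ (take j (sort (replicate n a ++ Z))) ≤ℤ j · a
sumℤ-take-sort-replicate-++ {j} {n} a Z j≤n =
  subst (λ m → sumℤ (take m (sort (replicate n a ++ Z))) ≤ℤ j · a) (List.length-replicate j)
    (sumℤ-take-sort-≤ (++⁺ʳ Z (replicate-⊆ a j≤n)))

sumℤ-take-sort-replicate-++-∈ : ∀ {j n z} a Z → j ≤ n → z ∈ Z →
  sumℤ (take (suc j) (sort (replicate n a ++ Z))) ≤ℤ j · a + z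
sumℤ-take-sort-replicate-++-∈ {j} {n} {z} a Z j≤n z∈Z =
  subst₂ (λ m w → sumℤ (take m (sort (replicate n a ++ Z))) ≤ℤ w)
    (trans (length-∷ʳ (replicate j a) z) (cong suc (List.length-replicate j)))
    (trans (sumℤ-++ (replicate j a) [ z ]) (cong (_+_ (j · a)) (ℤ.+-identityʳ z)))
    (sumℤ-take-sort-≤ (++⁺ (replicate-⊆ a j≤n) (from∈ z∈Z)))

sort-replicate : ∀ n a → sort (replicate n a) ≡ replicate n a
sort-replicate zero    a = refl
sort-replicate (suc n) a with sort-replicate n a
... | ih rewrite ih = insert-replicate n
  where
  insert-replicate : ∀ n → insert a (replicate n a) ≡ a ∷ replicate n a
  insert-replicate zero = refl
  insert-replicate (suc n) with a ℤ.≤? a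
  ... | yes _ = refl
  ... | no a≰a = ⊥-elim (a≰a ℤ.≤-refl)

lastSum : ℕ → List ℤ → List ℤ → ℤ
lastSum j D C with j ≤? length D
... | yes _ = sumℤ (drop (length D ∸ j) D)
... | no  _ = sumℤ D + sumℤ (take (j ∸ length D) C)

lastSum-∷ʳ : ∀ j D C u u′ → j ≤ length C → lastSum (suc j) (D ++ [ u ]) (C ++ [ u′ ]) ≡ u + lastSum j D C
lastSum-∷ʳ j D C u u′ j≤C with suc j ≤? length (D ++ [ u ]) | j ≤? length D
... | yes _    | yes _   rewrite length-∷ʳ D u = begin
    sumℤ (drop (length D ∸ j) (D ++ [ u ]))    ≡⟨ cong sumℤ (drop-++ˡ (length D ∸ j) D [ u ] (ℕ.m∸n≤m (length D) j)) ⟩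
    sumℤ (drop (length D ∸ j) D ++ [ u ])      ≡⟨ sumℤ-++ (drop (length D ∸ j) D) [ u ] ⟩
    sumℤ (drop (length D ∸ j) D) + (u + 0ℤ)    ≡⟨ rearrange (sumℤ (drop (length D ∸ j) D)) u ⟩
    u + sumℤ (drop (length D ∸ j) D)           ∎
  where
  open ≡-Reasoning
  rearrange : ∀ a b → a + (b + 0ℤ) ≡ b + a
  rearrange = solve-∀
... | yes 1+j≤ | no j≰D  rewrite length-∷ʳ D u = ⊥-elim (j≰D (ℕ.≤-pred 1+j≤))
... | no 1+j≰  | yes j≤D rewrite length-∷ʳ D u = ⊥-elim (1+j≰ (s≤s j≤D))
... | no _     | no _    rewrite length-∷ʳ D u = begin
    sumℤ (D ++ [ u ]) + sumℤ (take (j ∸ length D) (C ++ [ u′ ]))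
      ≡⟨ cong₂ _+_ (sumℤ-++ D [ u ]) (cong sumℤ (take-++ˡ (j ∸ length D) C [ u′ ] (ℕ.≤-trans (ℕ.m∸n≤m j (length D)) j≤C))) ⟩
    sumℤ D + (u + 0ℤ) + sumℤ (take (j ∸ length D) C)
      ≡⟨ rearrange (sumℤ D) u (sumℤ (take (j ∸ length D) C)) ⟩
    u + (sumℤ D + sumℤ (take (j ∸ length D) C))  ∎
  where
  open ≡-Reasoning
  rearrange : ∀ a b c → a + (b + 0ℤ) + c ≡ b + (a + c)
  rearrange = solve-∀

lastSum-++-pad : ∀ j D C C′ → j ≤ length C → lastSum j D (C ++ C′) ≡ lastSum j D C
lastSum-++-pad j D C C′ j≤C with j ≤? length D
... | yes _ = refl
... | no  _ = cong (λ L → sumℤ D + sumℤ L) (take-++ˡ (j ∸ length D) C C′ (ℕ.≤-trans (ℕ.m∸n≤m j (length D)) j≤C))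

lastSum-map-double : ∀ j D C → lastSum j (map double D) (map double C) ≡ double (lastSum j D C)
lastSum-map-double j D C with j ≤? length (map double D) | j ≤? length D
... | yes _  | yes _  rewrite List.length-map double D = trans (cong sumℤ (List.drop-map (length D ∸ j) D)) (sumℤ-map-double (drop (length D ∸ j) D))
... | yes j≤ | no j≰  rewrite List.length-map double D = ⊥-elim (j≰ j≤)
... | no j≰  | yes j≤ rewrite List.length-map double D = ⊥-elim (j≰ j≤)
... | no _   | no _   rewrite List.length-map double D = begin
    sumℤ (map double D) + sumℤ (take (j ∸ length D) (map double C))
      ≡⟨ cong₂ _+_ (sumℤ-map-double D) (cong sumℤ (List.take-map (j ∸ length D) C)) ⟩
    double (sumℤ D) + sumℤ (map double (take (j ∸ length D) C))
      ≡⟨ cong (_+_ (double (sumℤ D))) (sumℤ-map-double (take (j ∸ length D) C)) ⟩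
    double (sumℤ D) + double (sumℤ (take (j ∸ length D) C))
      ≡⟨ ℤ.*-distribˡ-+ (+ 2) (sumℤ D) (sumℤ (take (j ∸ length D) C)) ⟨
    double (sumℤ D + sumℤ (take (j ∸ length D) C)) ∎
  where open ≡-Reasoning

·≤lastSum : ∀ j D C → j ≤ length C → All (a ≤ℤ_) D → All (a ≤ℤ_) C → j · a ≤ℤ lastSum j D C
·≤lastSum {a} j D C j≤C a≤D a≤C with j ≤? length D
... | yes j≤D = subst (λ n → n · a ≤ℤ sumℤ (drop (length D ∸ j) D)) length-suffix
                  (·≤sumℤ (drop (length D ∸ j) D) (All.drop⁺ (length D ∸ j) a≤D))
  where
  length-suffix : length (drop (length D ∸ j) D) ≡ j
  length-suffix = trans (List.length-drop (length D ∸ j) D) (ℕ.m∸[m∸n]≡n j≤D)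
... | no  j≰D = subst (_≤ℤ sumℤ D + sumℤ (take (j ∸ length D) C)) split
                  (ℤ.+-mono-≤ (·≤sumℤ D a≤D)
                    (subst (λ n → n · a ≤ℤ sumℤ (take (j ∸ length D) C)) length-prefix
                      (·≤sumℤ (take (j ∸ length D) C) (All.take⁺ (j ∸ length D) a≤C))))
  where
  length-prefix : length (take (j ∸ length D) C) ≡ j ∸ length D
  length-prefix = trans (List.length-take (j ∸ length D) C) (ℕ.m≤n⇒m⊓n≡m (ℕ.≤-trans (ℕ.m∸n≤m j (length D)) j≤C))
  split : length D · a + (j ∸ length D) · a ≡ j · a
  split = trans (sym (·-+ (length D) (j ∸ length D) a)) (cong (_· a) (ℕ.m+[n∸m]≡n (ℕ.<⇒≤ (ℕ.≰⇒> j≰D))))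

private
  ≤-via : ∀ {a b c d} → c ≤ℤ d → a + d ≡ b + c → a ≤ℤ b
  ≤-via {a} {b} {c} {d} c≤d e =
    subst₂ _≤ℤ_ (cancel a d) (cancel b d) (ℤ.+-monoˡ-≤ (ℤ.- d) (subst (_≤ℤ b + d) (sym e) (ℤ.+-monoʳ-≤ b c≤d)))
    where cancel : ∀ a d → a + d + ℤ.- d ≡ a
          cancel = solve-∀

  <-via : ∀ {a b c d} → c ≤ℤ d → 1ℤ + a + d ≡ b + c → a <ℤ b
  <-via c≤d e = ℤ.suc[i]≤j⇒i<j (≤-via c≤d e)

  infixl 6 _⊕_
  _⊕_ : ∀ {a b c d} → a ≤ℤ b → c ≤ℤ d → a + c ≤ℤ b + d
  _⊕_ = ℤ.+-mono-≤

  0≤1 : 0ℤ ≤ℤ 1ℤ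
  0≤1 = ℤ.+≤+ z≤n

x+w≤τ∧m≤w⇒x<τ+1-m : ∀ {x w τ m} → x + w ≤ℤ τ → m ≤ℤ w → x <ℤ τ + 1ℤ - m
x+w≤τ∧m≤w⇒x<τ+1-m {x} {w} {τ} {m} h₁ h₂ = <-via (h₁ ⊕ h₂) (e x w τ m)
  where e : ∀ x w τ m → 1ℤ + x + (τ + w) ≡ τ + 1ℤ - m + (x + w + m)
        e = solve-∀

z≤o∧w≤t∧m≤z+w⇒τ<o+[τ+1-m+t] : ∀ {z o w t m τ} → z ≤ℤ o → w ≤ℤ t → m ≤ℤ z + w →
  τ <ℤ o + (τ + 1ℤ - m + t)
z≤o∧w≤t∧m≤z+w⇒τ<o+[τ+1-m+t] {z} {o} {w} {t} {m} {τ} h₁ h₂ h₃ = <-via (h₁ ⊕ h₂ ⊕ h₃) (e z o w t m τ)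
  where e : ∀ z o w t m τ → 1ℤ + τ + (o + t + (z + w)) ≡ o + (τ + 1ℤ - m + t) + (z + w + m)
        e = solve-∀

m≤w+z∧w≤t⇒τ<z+[τ+1-m+t] : ∀ {m w z t τ} → m ≤ℤ w + z → w ≤ℤ t → τ <ℤ z + (τ + 1ℤ - m + t)
m≤w+z∧w≤t⇒τ<z+[τ+1-m+t] {m} {w} {z} {t} {τ} h₁ h₂ = <-via (h₁ ⊕ h₂) (e m w z t τ)
  where e : ∀ m w z t τ → 1ℤ + τ + (w + z + t) ≡ z + (τ + 1ℤ - m + t) + (m + w)
        e = solve-∀

o+m≤τ+1∧w≤t⇒o+w≤τ+1-m+t : ∀ {o m τ w t} → o + m ≤ℤ τ + 1ℤ → w ≤ℤ t → o + w ≤ℤ τ + 1ℤ - m + t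
o+m≤τ+1∧w≤t⇒o+w≤τ+1-m+t {o} {m} {τ} {w} {t} h₁ h₂ = ≤-via (h₁ ⊕ h₂) (e o m τ w t)
  where e : ∀ o m τ w t → o + w + (τ + 1ℤ + t) ≡ τ + 1ℤ - m + t + (o + m + w)
        e = solve-∀

x+w≤t∧c+t≡τ∧m≤w+c⇒x<τ+1-m : ∀ {x w t c τ m} → x + w ≤ℤ t → c + t ≡ τ → m ≤ℤ w + c → x <ℤ τ + 1ℤ - m
x+w≤t∧c+t≡τ∧m≤w+c⇒x<τ+1-m {x} {w} {t} {c} {m = m} h₁ refl h₃ = <-via (h₁ ⊕ h₃) (e x w t c m)
  where e : ∀ x w t c m → 1ℤ + x + (t + (w + c)) ≡ c + t + 1ℤ - m + (x + w + m)
        e = solve-∀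

τ+1-m+m≡τ+1 : ∀ τ m → τ + 1ℤ - m + m ≡ τ + 1ℤ
τ+1-m+m≡τ+1 = solve-∀

x+m≡τ+1⇒x≡τ+1-m : ∀ {x m τ} → x + m ≡ τ + 1ℤ → x ≡ τ + 1ℤ - m
x+m≡τ+1⇒x≡τ+1-m {x} {m} h = trans (sym (e x m)) (cong (_- m) h)
  where e : ∀ x m → x + m - m ≡ x
        e = solve-∀

x<y⇒2x<2y : ∀ {x y} → x <ℤ y → double x <ℤ double y
x<y⇒2x<2y {x} {y} h = <-via (ℤ.i<j⇒suc[i]≤j h ⊕ ℤ.<⇒≤ h) (e x y)
  where e : ∀ x y → 1ℤ + + 2 * x + (y + y) ≡ + 2 * y + (1ℤ + x + x)
        e = solve-∀

z+w≤τ⇒2z+2w≤2τ+1 : ∀ {z w τ} → z + w ≤ℤ τ → double z + double w ≤ℤ double τ + 1ℤ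
z+w≤τ⇒2z+2w≤2τ+1 {z} {w} {τ} h = ≤-via (h ⊕ h ⊕ 0≤1) (e z w τ)
  where e : ∀ z w τ → + 2 * z + + 2 * w + (τ + τ + 1ℤ) ≡ + 2 * τ + 1ℤ + (z + w + (z + w) + 0ℤ)
        e = solve-∀

w≤t⇒2τ+1-2t+2w≤2τ+1 : ∀ {w t τ} → w ≤ℤ t → double τ + 1ℤ - double t + double w ≤ℤ double τ + 1ℤ
w≤t⇒2τ+1-2t+2w≤2τ+1 {w} {t} {τ} h = ≤-via (h ⊕ h) (e w t τ)
  where e : ∀ w t τ → + 2 * τ + 1ℤ - + 2 * t + + 2 * w + (t + t) ≡ + 2 * τ + 1ℤ + (w + w)
        e = solve-∀

τ<o+t⇒2τ+1<2o+2t : ∀ {τ o t} → τ <ℤ o + t → double τ + 1ℤ <ℤ double o + double t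
τ<o+t⇒2τ+1<2o+2t {τ} {o} {t} h = <-via (ℤ.i<j⇒suc[i]≤j h ⊕ ℤ.i<j⇒suc[i]≤j h) (e τ o t)
  where e : ∀ τ o t → 1ℤ + (+ 2 * τ + 1ℤ) + (o + t + (o + t)) ≡ + 2 * o + + 2 * t + (1ℤ + τ + (1ℤ + τ))
        e = solve-∀

o+w≤t⇒2o+2w≤2t : ∀ {o w t} → o + w ≤ℤ t → double o + double w ≤ℤ double t
o+w≤t⇒2o+2w≤2t {o} {w} {t} h = ≤-via (h ⊕ h) (e o w t)
  where e : ∀ o w t → + 2 * o + + 2 * w + (t + t) ≡ + 2 * t + (o + w + (o + w))
        e = solve-∀

o+w≤t∧m≤2w+[2τ+1-2t]⇒2o+m≤2τ+1+1 : ∀ {o w t m τ} → o + w ≤ℤ t → m ≤ℤ double w + (double τ + 1ℤ - double t) →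
  double o + m ≤ℤ double τ + 1ℤ + 1ℤ
o+w≤t∧m≤2w+[2τ+1-2t]⇒2o+m≤2τ+1+1 {o} {w} {t} {m} {τ} h₁ h₂ = ≤-via (h₁ ⊕ h₁ ⊕ h₂ ⊕ 0≤1) (e o w t m τ)
  where e : ∀ o w t m τ → + 2 * o + m + (t + t + (+ 2 * w + (+ 2 * τ + 1ℤ - + 2 * t)) + 1ℤ)
                         ≡ + 2 * τ + 1ℤ + 1ℤ + (o + w + (o + w) + m + 0ℤ)
        e = solve-∀

2τ+1-2t+2t≡2τ+1 : ∀ τ t → double τ + 1ℤ - double t + double t ≡ double τ + 1ℤ
2τ+1-2t+2t≡2τ+1 = e
  where e : ∀ τ t → + 2 * τ + 1ℤ - + 2 * t + + 2 * t ≡ + 2 * τ + 1ℤ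
        e = solve-∀

τ<x+t⇒2τ+1-2t<2x : ∀ {τ x t} → τ <ℤ x + t → double τ + 1ℤ - double t <ℤ double x
τ<x+t⇒2τ+1-2t<2x {τ} {x} {t} h = <-via (ℤ.i<j⇒suc[i]≤j h ⊕ ℤ.i<j⇒suc[i]≤j h) (e τ x t)
  where e : ∀ τ x t → 1ℤ + (+ 2 * τ + 1ℤ - + 2 * t) + (x + t + (x + t)) ≡ + 2 * x + (1ℤ + τ + (1ℤ + τ))
        e = solve-∀

c+t≡τ⇒2c<2τ+1-2t : ∀ {c t τ} → c + t ≡ τ → double c <ℤ double τ + 1ℤ - double t
c+t≡τ⇒2c<2τ+1-2t {c} {t} refl = ℤ.suc[i]≤j⇒i<j (ℤ.≤-reflexive (e c t))
  where e : ∀ c t → 1ℤ + + 2 * c ≡ + 2 * (c + t) + 1ℤ - + 2 * t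
        e = solve-∀

-- Relative order of the labels of two positions

module Ordering (s : ℕ) where

  SomeBetween : List Bool → Bool → ℕ → ℕ → Set
  SomeBetween B t p q = ∃[ l ] p < l × l < q × B ‼ l ≡ just t

  AllBetween : List Bool → Bool → ℕ → ℕ → Set
  AllBetween B t p q = ∀ l → p < l → l < q → B ‼ l ≡ just t

  -- The lemma for positions p < q with bits a, a′ and labels x, y.
  Related : List Bool → ℕ → ℕ → Bool → Bool → ℤ → ℤ → Set
  Related B p q true  true  x y = (SomeBetween B false p q → x <ℤ y) × (AllBetween B true p q → x ≡ y)
  Related B p q false true  x y = x <ℤ y
  Related B p q true  false x y = y <ℤ x
  Related B p q false false x y =
    (q ≤ s → x ≡ y) × (s < p → (SomeBetween B true p q → y <ℤ x) × (AllBetween B false p q → x <ℤ y))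

  Ordered : List Bool → (ℕ → ℤ) → Set
  Ordered B c = ∀ {p q a a′} → p < q → B ‼ p ≡ just a → B ‼ q ≡ just a′ → Related B p q a a′ (c p) (c q)

  Related-map : ∀ {B p q} a a′ {x y} (f : ℤ → ℤ) → (∀ {x y} → x <ℤ y → f x <ℤ f y) →
    Related B p q a a′ x y → Related B p q a a′ (f x) (f y)
  Related-map true  true  f f-mono (<y , ≡y) = f-mono ∘ <y , cong f ∘ ≡y
  Related-map false true  f f-mono x<y = f-mono x<y
  Related-map true  false f f-mono y<x = f-mono y<x
  Related-map false false f f-mono (≡y , after-s) =
    cong f ∘ ≡y , λ s<p → f-mono ∘ proj₁ (after-s s<p) , f-mono ∘ proj₂ (after-s s<p)

  Related-∷ʳ : ∀ {B p q} a a′ t {x y} → q ≤ length B →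
    Related B p q a a′ x y → Related (B ++ [ t ]) p q a a′ x y
  Related-∷ʳ {B} {p} {q} a a′ t {x} {y} q≤B r = go a a′ r
    where
    shrink : ∀ {l} → l < q → (B ++ [ t ]) ‼ l ≡ B ‼ l
    shrink {l} l<q = ‼-∷ʳ B t l (ℕ.≤-trans (ℕ.<⇒≤ l<q) q≤B)
    some : ∀ {t′} → SomeBetween (B ++ [ t ]) t′ p q → SomeBetween B t′ p q
    some (l , p<l , l<q , e) = l , p<l , l<q , trans (sym (shrink l<q)) e
    all : ∀ {t′} → AllBetween (B ++ [ t ]) t′ p q → AllBetween B t′ p q
    all h l p<l l<q = trans (sym (shrink l<q)) (h l p<l l<q)
    go : ∀ a a′ → Related B p q a a′ x y → Related (B ++ [ t ]) p q a a′ x y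
    go true  true  (<y , ≡y)     = (λ b → <y (some b)) , (λ b → ≡y (all b))
    go false true  r             = r
    go true  false r             = r
    go false false (≡y , after-s) =
      ≡y , λ s<p → (λ b → proj₁ (after-s s<p) (some b)) , (λ b → proj₂ (after-s s<p) (all b))

  nothing-between : ∀ {B t n} → ¬ SomeBetween B t n (suc n)
  nothing-between (l , n<l , l<1+n , _) = ℕ.<-irrefl refl (ℕ.<-≤-trans n<l (ℕ.≤-pred l<1+n))

  SomeBetween-∷ʳ : ∀ {B t t′ p} → B ‼ length B ≡ just (not t′) →
    SomeBetween (B ++ [ t ]) t′ p (suc (length B)) → SomeBetween B t′ p (length B)
  SomeBetween-∷ʳ {B} {t} {t′} last (l , p<l , l<1+n , e) with ℕ.m≤n⇒m<n∨m≡n (ℕ.≤-pred l<1+n)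
  ... | inj₁ l<n  = l , p<l , l<n , trans (sym (‼-∷ʳ B t l (ℕ.<⇒≤ l<n))) e
  ... | inj₂ refl = ⊥-elim (‼-just-not {B} (trans (sym (‼-∷ʳ B t l ℕ.≤-refl)) e) last)

  AllBetween-∷ʳ : ∀ {B t t′ p} → AllBetween (B ++ [ t ]) t′ p (suc (length B)) → AllBetween B t′ p (length B)
  AllBetween-∷ʳ {B} {t} all l p<l l<n = trans (sym (‼-∷ʳ B t l (ℕ.<⇒≤ l<n))) (all l p<l (ℕ.m≤n⇒m≤1+n l<n))

  AllBetween-∷ʳ-last : ∀ {B t t′ p} → AllBetween (B ++ [ t ]) t′ p (suc (length B)) → p < length B →
    B ‼ length B ≡ just t′
  AllBetween-∷ʳ-last {B} {t} all p<n = trans (sym (‼-∷ʳ B t (length B) ℕ.≤-refl)) (all (length B) p<n ℕ.≤-refl)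

  Ordered-∷ʳ : ∀ {B c c′} t y (f : ℤ → ℤ) → (∀ {x y} → x <ℤ y → f x <ℤ f y) → Ordered B c →
    (∀ i → i ≤ length B → c′ i ≡ f (c i)) → c′ (suc (length B)) ≡ y →
    (∀ {p a} → p ≤ length B → B ‼ p ≡ just a → Related (B ++ [ t ]) p (suc (length B)) a t (f (c p)) y) →
    Ordered (B ++ [ t ]) c′
  Ordered-∷ʳ {B} {c} {c′} t y f f-mono ord c′≡ c′-last new {p} {q} {a} {a′} p<q B′p B′q
    with ℕ.m≤n⇒m<n∨m≡n (subst (q ≤_) (length-∷ʳ B t) (proj₂ (‼-just⇒bounds (B ++ [ t ]) q B′q)))
  ... | inj₂ refl with trans (sym B′q) (‼-∷ʳ-last B t)
  ...   | refl rewrite c′≡ p (ℕ.≤-pred p<q) | c′-last =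
    new (ℕ.≤-pred p<q) (trans (sym (‼-∷ʳ B t p (ℕ.≤-pred p<q))) B′p)
  Ordered-∷ʳ {B} {c} {c′} t y f f-mono ord c′≡ c′-last new {p} {q} {a} {a′} p<q B′p B′q
      | inj₁ (s≤s q≤B) rewrite c′≡ p (ℕ.≤-trans (ℕ.<⇒≤ p<q) q≤B) | c′≡ q q≤B =
    Related-∷ʳ a a′ t q≤B (Related-map a a′ f f-mono
      (ord p<q (trans (sym (‼-∷ʳ B t p (ℕ.≤-trans (ℕ.<⇒≤ p<q) q≤B))) B′p) (trans (sym (‼-∷ʳ B t q q≤B)) B′q)))

  next-between : ∀ {b t i i₂ j} → i ≤ i₂ → i₂ < j → b ‼ suc i₂ ≡ just (not t) → b ‼ j ≡ just t →
    SomeBetween b (not t) i j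
  next-between {b} i≤i₂ i₂<j next bj =
    suc _ , s≤s i≤i₂ , ℕ.≤∧≢⇒< i₂<j (λ { refl → ‼-just-not {b} bj next }) , next

  AllBetween-inside : ∀ {b t i₁ i₂} → (∀ l → i₁ ≤ l → l ≤ i₂ → b ‼ l ≡ just t) →
    ∀ {i j} → i₁ ≤ i → j ≤ i₂ → AllBetween b t i j
  AllBetween-inside all i₁≤i j≤i₂ l i<l l<j = all l (ℕ.≤-trans i₁≤i (ℕ.<⇒≤ i<l)) (ℕ.≤-trans (ℕ.<⇒≤ l<j) j≤i₂)

  module _ {b : List Bool} {c : ℕ → ℤ} (ord : Ordered b c) where

    increasing-across-1-intervals : ∀ {i₁ i₂ i₃ i₄} → IsInterval b true i₁ i₂ → IsInterval b true i₃ i₄ → i₂ < i₃ →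
      ∀ {i j} → i₁ ≤ i → i ≤ i₂ → i₃ ≤ j → j ≤ i₄ → c i <ℤ c j
    increasing-across-1-intervals {i₂ = i₂} (_ , _ , _ , ones₁ , _ , next) (_ , i₃≤i₄ , i₄≤n , ones₂ , _ , _) i₂<i₃
                                  {j = j} i₁≤i i≤i₂ i₃≤j j≤i₄ =
      proj₁ (ord (ℕ.≤-<-trans i≤i₂ i₂<j) (ones₁ _ i₁≤i i≤i₂) bj)
        (next-between {b} i≤i₂ i₂<j (next (ℕ.<-≤-trans i₂<i₃ (ℕ.≤-trans i₃≤i₄ i₄≤n))) bj)
      where
      i₂<j : i₂ < j
      i₂<j = ℕ.<-≤-trans i₂<i₃ i₃≤j
      bj : b ‼ j ≡ just true
      bj = ones₂ j i₃≤j j≤i₄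

    decreasing-across-0-intervals : ∀ {i₁ i₂ i₃ i₄} → IsInterval b false i₁ i₂ → IsInterval b false i₃ i₄ →
      s < i₁ → i₂ < i₃ → ∀ {i j} → i₁ ≤ i → i ≤ i₂ → i₃ ≤ j → j ≤ i₄ → c j <ℤ c i
    decreasing-across-0-intervals {i₂ = i₂} (_ , _ , _ , zeros₁ , _ , next) (_ , i₃≤i₄ , i₄≤n , zeros₂ , _ , _) s<i₁ i₂<i₃
                                  {j = j} i₁≤i i≤i₂ i₃≤j j≤i₄ =
      proj₁ (proj₂ (ord (ℕ.≤-<-trans i≤i₂ i₂<j) (zeros₁ _ i₁≤i i≤i₂) bj) (ℕ.<-≤-trans s<i₁ i₁≤i))
        (next-between {b} i≤i₂ i₂<j (next (ℕ.<-≤-trans i₂<i₃ (ℕ.≤-trans i₃≤i₄ i₄≤n))) bj)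
      where
      i₂<j : i₂ < j
      i₂<j = ℕ.<-≤-trans i₂<i₃ i₃≤j
      bj : b ‼ j ≡ just false
      bj = zeros₂ j i₃≤j j≤i₄

    increasing-within-0-interval : ∀ {i₅ i₆} → IsInterval b false i₅ i₆ → s < i₅ →
      ∀ {i j} → i₅ ≤ i → i < j → j ≤ i₆ → c i <ℤ c j
    increasing-within-0-interval (_ , _ , _ , zeros , _ , _) s<i₅ i₅≤i i<j j≤i₆ =
      proj₂ (proj₂ (ord i<j (zeros _ i₅≤i (ℕ.≤-trans (ℕ.<⇒≤ i<j) j≤i₆)) (zeros _ (ℕ.≤-trans i₅≤i (ℕ.<⇒≤ i<j)) j≤i₆))
                   (ℕ.<-≤-trans s<i₅ i₅≤i))
        (AllBetween-inside {b} zeros i₅≤i j≤i₆)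

    constant-on-1-interval : ∀ {i₅ i₆} → IsInterval b true i₅ i₆ →
      ∀ {i j} → i₅ ≤ i → i ≤ i₆ → i₅ ≤ j → j ≤ i₆ → c i ≡ c j
    constant-on-1-interval (_ , _ , _ , ones , _ , _) {i} {j} i₅≤i i≤i₆ i₅≤j j≤i₆ with ℕ.<-cmp i j
    ... | tri< i<j _ _ = proj₂ (ord i<j (ones i i₅≤i i≤i₆) (ones j i₅≤j j≤i₆)) (AllBetween-inside {b} ones i₅≤i j≤i₆)
    ... | tri≈ _ refl _ = refl
    ... | tri> _ _ j<i = sym (proj₂ (ord j<i (ones j i₅≤j j≤i₆) (ones i i₅≤i i≤i₆)) (AllBetween-inside {b} ones i₅≤j i≤i₆))

    constant-on-prefix : (∀ i → 1 ≤ i → i ≤ s → b ‼ i ≡ just false) →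
      ∀ {i j} → 1 ≤ i → i ≤ s → 1 ≤ j → j ≤ s → c i ≡ c j
    constant-on-prefix zeros {i} {j} 1≤i i≤s 1≤j j≤s with ℕ.<-cmp i j
    ... | tri< i<j _ _ = proj₁ (ord i<j (zeros i 1≤i i≤s) (zeros j 1≤j j≤s)) j≤s
    ... | tri≈ _ refl _ = refl
    ... | tri> _ _ j<i = sym (proj₁ (ord j<i (zeros j 1≤j j≤s) (zeros i 1≤i i≤s)) i≤s)

    zero-labels<one-labels : ∀ {i j} → b ‼ i ≡ just false → b ‼ j ≡ just true → c i <ℤ c j
    zero-labels<one-labels {i} {j} bi bj with ℕ.<-cmp i j
    ... | tri< i<j _ _ = ord i<j bi bj
    ... | tri≈ _ refl _ = ⊥-elim (‼-just-not {b} bj bi)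
    ... | tri> _ _ j<i = ord j<i bj bi

  0-interval-after-prefix : ∀ {b i₅ i₆} → (∀ i → 1 ≤ i → i ≤ s → b ‼ i ≡ just false) → b ‼ suc s ≡ just true →
    s < length b → IsInterval b false i₅ i₆ → ¬ (i₅ ≡ 1 × i₆ ≡ s) → s < i₅
  0-interval-after-prefix {b} {i₅} {i₆} zeros one s<n (1≤i₅ , i₅≤i₆ , _ , all , prev , next) not-prefix
    with ℕ.≤-<-connex i₅ s
  ... | inj₂ s<i₅ = s<i₅
  ... | inj₁ i₅≤s = ⊥-elim (not-prefix (i₅≡1 , ℕ.≤-antisym i₆≤s s≤i₆))
    where
    i₅≡1 : i₅ ≡ 1
    i₅≡1 with ℕ.≤-<-connex i₅ 1
    ... | inj₁ i₅≤1 = ℕ.≤-antisym i₅≤1 1≤i₅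
    ... | inj₂ 1<i₅ = ⊥-elim (‼-just-not {b} (prev 1<i₅)
                        (zeros (i₅ ∸ 1) (ℕ.∸-monoˡ-≤ 1 1<i₅) (ℕ.≤-trans (ℕ.m∸n≤m i₅ 1) i₅≤s)))
    i₆≤s : i₆ ≤ s
    i₆≤s with ℕ.≤-<-connex i₆ s
    ... | inj₁ i₆≤s = i₆≤s
    ... | inj₂ s<i₆ = ⊥-elim (‼-just-not {b} (all (suc s) (ℕ.m≤n⇒m≤1+n i₅≤s) s<i₆) one)
    s≤i₆ : s ≤ i₆
    s≤i₆ with ℕ.≤-<-connex s i₆
    ... | inj₁ s≤i₆ = s≤i₆
    ... | inj₂ i₆<s = ⊥-elim (‼-just-not {b} (zeros (suc i₆) (s≤s z≤n) i₆<s) (next (ℕ.<-trans i₆<s s<n)))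

-- The construction

-- k is passed as k-2 so that k ∸ 1 reduces to suc k-2.
module Construction (k-2 s : ℕ) (k-1≤s : suc k-2 ≤ s) where

  open Ordering s

  k k-1 : ℕ
  k   = suc (suc k-2)
  k-1 = suc k-2

  -- Every state of the run is st (bitsOf bs) (labelsOf z₀ cs) τ; for it, zerosSum
  -- is the Σ_{j∈L} c(j) of a 1-step and onesSum the Σ_{j∈D'} c(j) of a 0-step.
  bitsOf : List Bool → List Bool
  bitsOf bs = replicate s false ++ bs

  labelsOf : ℤ → List ℤ → List ℤ
  labelsOf z₀ cs = replicate s z₀ ++ cs

  zerosSum : ℤ → List Bool → List ℤ → ℤ
  zerosSum z₀ bs cs = sumℤ (take k-1 (sort (replicate s z₀ ++ labelsWith false bs cs)))

  onesSum : ℤ → List Bool → List ℤ → ℤ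
  onesSum z₀ bs cs = lastSum k-1 (labelsWith true bs cs) (labelsOf z₀ cs)

  step-false : ∀ B C τ →
    step k (st B C τ) false ≡
      st (B ++ [ false ]) (map double C ++ [ double τ + 1ℤ - double (lastSum k-1 (labelsWith true B C) C) ])
         (double τ + 1ℤ)
  step-false B C τ with k-1 ≤? length (labelsWith true B C)
  ... | yes _ = refl
  ... | no  _ = cong (λ v → st (B ++ [ false ]) (map double C ++ [ v ]) (double τ + 1ℤ))
                  (subtract-twice (double τ + 1ℤ) (sumℤ (labelsWith true B C)) _)
    where
    subtract-twice : ∀ a x y → a - + 2 * x - + 2 * y ≡ a - + 2 * (x + y)
    subtract-twice = solve-∀

  bits-foldl-step : ∀ xs σ → bits (foldl (step k) σ xs) ≡ bits σ ++ xs
  bits-foldl-step []          σ          = sym (List.++-identityʳ (bits σ))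
  bits-foldl-step (true ∷ xs) (st B C τ) =
    trans (bits-foldl-step xs (step k (st B C τ) true)) (List.++-assoc B [ true ] xs)
  bits-foldl-step (false ∷ xs) (st B C τ) rewrite step-false B C τ =
    trans (bits-foldl-step xs _) (List.++-assoc B [ false ] xs)

  step-true-shape : ∀ z₀ bs cs τ →
    step k (st (bitsOf bs) (labelsOf z₀ cs) τ) true ≡
      st (bitsOf (bs ++ [ true ])) (labelsOf z₀ (cs ++ [ τ + 1ℤ - zerosSum z₀ bs cs ])) τ
  step-true-shape z₀ bs cs τ =
    cong₂ (λ B C → st B C τ) (List.++-assoc (replicate s false) bs [ true ])
      (trans (cong (λ L → labelsOf z₀ cs ++ [ τ + 1ℤ - sumℤ (take k-1 (sort L)) ])
                   (labelsWith-false-zeros++ s z₀ bs cs))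
             (List.++-assoc (replicate s z₀) cs _))

  labelsOf-map-double : ∀ z₀ cs → map double (labelsOf z₀ cs) ≡ labelsOf (double z₀) (map double cs)
  labelsOf-map-double z₀ cs = trans (List.map-++ double (replicate s z₀) cs)
                                (cong (_++ map double cs) (List.map-replicate double s z₀))

  step-false-shape : ∀ z₀ bs cs τ →
    step k (st (bitsOf bs) (labelsOf z₀ cs) τ) false ≡
      st (bitsOf (bs ++ [ false ]))
         (labelsOf (double z₀) (map double cs ++ [ double τ + 1ℤ - double (onesSum z₀ bs cs) ]))
         (double τ + 1ℤ)
  step-false-shape z₀ bs cs τ =
    trans (step-false (bitsOf bs) (labelsOf z₀ cs) τ)
      (cong₂ (λ B C → st B C (double τ + 1ℤ)) (List.++-assoc (replicate s false) bs [ false ])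
        (begin
          map double (labelsOf z₀ cs) ++ [ v (labelsWith true (bitsOf bs) (labelsOf z₀ cs)) ]
            ≡⟨ cong (λ D → map double (labelsOf z₀ cs) ++ [ v D ]) (labelsWith-true-zeros++ s z₀ bs cs) ⟩
          map double (labelsOf z₀ cs) ++ [ v (labelsWith true bs cs) ]
            ≡⟨ cong (_++ [ v (labelsWith true bs cs) ]) (labelsOf-map-double z₀ cs) ⟩
          labelsOf (double z₀) (map double cs) ++ [ v (labelsWith true bs cs) ]
            ≡⟨ List.++-assoc (replicate s (double z₀)) (map double cs) _ ⟩
          labelsOf (double z₀) (map double cs ++ [ v (labelsWith true bs cs) ]) ∎))
    where
    open ≡-Reasoning
    v : List ℤ → ℤ
    v D = double τ + 1ℤ - double (lastSum k-1 D (labelsOf z₀ cs))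

  length-bitsOf≡length-labelsOf : ∀ z₀ bs cs → length bs ≡ length cs → length (bitsOf bs) ≡ length (labelsOf z₀ cs)
  length-bitsOf≡length-labelsOf z₀ bs cs e =
    trans (length-replicate-++ s false bs) (trans (cong (s ℕ.+_) e) (sym (length-replicate-++ s z₀ cs)))

  s<length-bitsOf : ∀ bs → 1 ≤ length bs → s < length (bitsOf bs)
  s<length-bitsOf bs ne = subst (s <_) (sym (length-replicate-++ s false bs)) (ℕ.m<m+n s ne)

  bitsOf-∷ʳ : ∀ bs t → bitsOf (bs ++ [ t ]) ≡ bitsOf bs ++ [ t ]
  bitsOf-∷ʳ bs t = sym (List.++-assoc (replicate s false) bs [ t ])

  labelsOf-∷ʳ : ∀ z₀ cs u → labelsOf z₀ (cs ++ [ u ]) ≡ labelsOf z₀ cs ++ [ u ]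
  labelsOf-∷ʳ z₀ cs u = sym (List.++-assoc (replicate s z₀) cs [ u ])

  one-label : ∀ {P : ℤ → Set} z₀ bs cs p → length bs ≡ length cs → All P (labelsWith true bs cs) →
    bitsOf bs ‼ p ≡ just true → P (labelsOf z₀ cs ! p)
  one-label {P} z₀ bs cs p e ones =
    All-labelsWith true (bitsOf bs) (labelsOf z₀ cs) p (length-bitsOf≡length-labelsOf z₀ bs cs e)
      (subst (All P) (sym (labelsWith-true-zeros++ s z₀ bs cs)) ones)

  zero-label-after-s : ∀ {P : ℤ → Set} z₀ bs cs p → length bs ≡ length cs → s < p →
    All P (labelsWith false bs cs) → bitsOf bs ‼ p ≡ just false → P (labelsOf z₀ cs ! p)
  zero-label-after-s {P} z₀ bs cs p e s<p zeros b
    with p ∸ suc s | sym (trans (ℕ.+-suc s (p ∸ suc s)) (ℕ.m+[n∸m]≡n s<p))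
  ... | q | refl =
    subst P (sym (cong (fromMaybe 0ℤ) (‼-replicate-++-shift s z₀ cs q)))
      (All-labelsWith false bs cs (suc q) e zeros (trans (sym (‼-replicate-++-shift s false bs q)) b))

  zero-label : ∀ {P : ℤ → Set} z₀ bs cs p → length bs ≡ length cs → P z₀ →
    All P (labelsWith false bs cs) → bitsOf bs ‼ p ≡ just false → P (labelsOf z₀ cs ! p)
  zero-label {P} z₀ bs cs p e pz zeros b with ℕ.≤-<-connex p s
  ... | inj₂ s<p = zero-label-after-s z₀ bs cs p e s<p zeros b
  ... | inj₁ p≤s = subst P (sym (cong (fromMaybe 0ℤ) (‼-replicate-++ s z₀ cs p 1≤p p≤s))) pz
    where
    1≤p : 1 ≤ p
    1≤p = proj₁ (‼-just⇒bounds (bitsOf bs) p b)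

  s≤length-labelsOf : ∀ z₀ cs → s ≤ length (labelsOf z₀ cs)
  s≤length-labelsOf z₀ cs = subst (s ≤_) (sym (length-replicate-++ s z₀ cs)) (ℕ.m≤m+n s (length cs))

  ·≤lastSum-labelsOf : ∀ {j z₀} D cs → j ≤ s → All (z₀ ≤ℤ_) D → j · z₀ ≤ℤ lastSum j D (labelsOf z₀ cs)
  ·≤lastSum-labelsOf {j} {z₀} D cs j≤s z₀≤D =
    subst (j · z₀ ≤ℤ_) (sym (lastSum-++-pad j D (replicate s z₀) cs j≤prefix))
      (·≤lastSum j D (replicate s z₀) j≤prefix z₀≤D (All.replicate⁺ s ℤ.≤-refl))
    where
    j≤prefix : j ≤ length (replicate s z₀)
    j≤prefix = subst (j ≤_) (sym (List.length-replicate s)) j≤s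

  bitsOf-∷ʳ-last : ∀ bs t → bitsOf (bs ++ [ t ]) ‼ length (bitsOf (bs ++ [ t ])) ≡ just t
  bitsOf-∷ʳ-last bs t rewrite bitsOf-∷ʳ bs t | length-∷ʳ (bitsOf bs) t = ‼-∷ʳ-last (bitsOf bs) t

  labelsOf-∷ʳ-last : ∀ z₀ bs cs t u → length bs ≡ length cs →
    labelsOf z₀ (cs ++ [ u ]) ! length (bitsOf (bs ++ [ t ])) ≡ u
  labelsOf-∷ʳ-last z₀ bs cs t u e
    rewrite bitsOf-∷ʳ bs t | labelsOf-∷ʳ z₀ cs u | length-∷ʳ (bitsOf bs) t
          | length-bitsOf≡length-labelsOf z₀ bs cs e = !-∷ʳ-last (labelsOf z₀ cs) u

  record Invariant (z₀ : ℤ) (bs : List Bool) (cs : List ℤ) (τ : ℤ) : Set where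
    field
      length≡           : length bs ≡ length cs
      nonempty          : 1 ≤ length bs
      z₀<ones           : All (z₀ <ℤ_) (labelsWith true bs cs)
      z₀-bound          : z₀ + k-1 · z₀ ≤ℤ τ
      zeros-bound       : All (λ z → z + k-1 · z₀ ≤ℤ τ) (labelsWith false bs cs)
      τ<ones+onesSum    : All (λ o → τ <ℤ o + onesSum z₀ bs cs) (labelsWith true bs cs)
      ones+·≤onesSum    : All (λ o → o + k-2 · z₀ ≤ℤ onesSum z₀ bs cs) (labelsWith true bs cs)
      ones+zerosSum≤τ+1 : All (λ o → o + zerosSum z₀ bs cs ≤ℤ τ + 1ℤ) (labelsWith true bs cs)
      last-one          : bitsOf bs ‼ length (bitsOf bs) ≡ just true →
                          labelsOf z₀ cs ! length (bitsOf bs) + zerosSum z₀ bs cs ≡ τ + 1ℤ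
      last-zero         : bitsOf bs ‼ length (bitsOf bs) ≡ just false →
                          labelsOf z₀ cs ! length (bitsOf bs) + onesSum z₀ bs cs ≡ τ
      τ<zeros+onesSum   : bitsOf bs ‼ length (bitsOf bs) ≡ just true →
                          All (λ z → τ <ℤ z + onesSum z₀ bs cs) (labelsWith false bs cs)
      ordered           : Ordered (bitsOf bs) (labelsOf z₀ cs !_)

  module AppendOne {z₀ bs cs τ} (I : Invariant z₀ bs cs τ) where
    open Invariant I

    B : List Bool
    B = bitsOf bs

    C : List ℤ
    C = labelsOf z₀ cs

    ones zeros : List ℤ
    ones  = labelsWith true bs cs
    zeros = labelsWith false bs cs

    M u T₂ : ℤ
    M  = zerosSum z₀ bs cs
    u  = τ + 1ℤ - M
    T₂ = lastSum k-2 ones C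

    k-2≤s : k-2 ≤ s
    k-2≤s = ℕ.≤-trans (ℕ.n≤1+n k-2) k-1≤s

    ones′ : labelsWith true (bs ++ [ true ]) (cs ++ [ u ]) ≡ ones ++ [ u ]
    ones′ = labelsWith-∷ʳ true true bs cs u length≡

    zeros′ : labelsWith false (bs ++ [ true ]) (cs ++ [ u ]) ≡ zeros
    zeros′ = trans (labelsWith-∷ʳ false true bs cs u length≡) (List.++-identityʳ zeros)

    zerosSum′ : zerosSum z₀ (bs ++ [ true ]) (cs ++ [ u ]) ≡ M
    zerosSum′ = cong (λ Z → sumℤ (take k-1 (sort (replicate s z₀ ++ Z)))) zeros′

    onesSum′ : onesSum z₀ (bs ++ [ true ]) (cs ++ [ u ]) ≡ u + T₂
    onesSum′ = trans (cong₂ (lastSum k-1) ones′ (labelsOf-∷ʳ z₀ cs u))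
                 (lastSum-∷ʳ k-2 ones C u u (ℕ.≤-trans k-2≤s (s≤length-labelsOf z₀ cs)))

    M≤k-1·z₀ : M ≤ℤ k-1 · z₀
    M≤k-1·z₀ = sumℤ-take-sort-replicate-++ z₀ zeros k-1≤s

    M≤k-2·z₀+zeros : All (λ z → M ≤ℤ k-2 · z₀ + z) zeros
    M≤k-2·z₀+zeros = All.tabulate (sumℤ-take-sort-replicate-++-∈ z₀ zeros k-2≤s)

    k-2·z₀≤T₂ : k-2 · z₀ ≤ℤ T₂
    k-2·z₀≤T₂ = ·≤lastSum-labelsOf ones cs k-2≤s (All.map ℤ.<⇒≤ z₀<ones)

    z₀<u : z₀ <ℤ u
    z₀<u = x+w≤τ∧m≤w⇒x<τ+1-m {τ = τ} z₀-bound M≤k-1·z₀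

    τ<o+u+T₂ : ∀ {o} → z₀ <ℤ o → τ <ℤ o + (u + T₂)
    τ<o+u+T₂ z₀<o = z≤o∧w≤t∧m≤z+w⇒τ<o+[τ+1-m+t] {τ = τ} (ℤ.<⇒≤ z₀<o) k-2·z₀≤T₂ M≤k-1·z₀

    s<n : s < length B
    s<n = s<length-bitsOf bs nonempty

    length-B≡length-C : length B ≡ length C
    length-B≡length-C = length-bitsOf≡length-labelsOf z₀ bs cs length≡

    related-to-new : ∀ {p a} → p ≤ length B → B ‼ p ≡ just a → Related (B ++ [ true ]) p (suc (length B)) a true (C ! p) u
    related-to-new {p} {false} _   b = x+w≤τ∧m≤w⇒x<τ+1-m {τ = τ} (zero-label z₀ bs cs p length≡ z₀-bound zeros-bound b) M≤k-1·z₀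
    related-to-new {p} {true}  p≤n b with ℕ.m≤n⇒m<n∨m≡n p≤n
    ... | inj₂ refl = ⊥-elim ∘ nothing-between {B ++ [ true ]} , λ _ → x+m≡τ+1⇒x≡τ+1-m {τ = τ} (last-one b)
    ... | inj₁ p<n with ‼-last B (ℕ.≤-trans (s≤s z≤n) s<n)
    ...   | true , Bn =
      (λ some → subst (C ! p <ℤ_) Cn≡u (proj₁ r (SomeBetween-∷ʳ {B} Bn some))) ,
      (λ all → trans (proj₂ r (AllBetween-∷ʳ {B} all)) Cn≡u)
      where
      r : Related B p (length B) true true (C ! p) (C ! length B)
      r = ordered p<n b Bn
      Cn≡u : C ! length B ≡ u
      Cn≡u = x+m≡τ+1⇒x≡τ+1-m {τ = τ} (last-one Bn)
    ...   | false , Bn =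
      -- c(p) + (k-2)z₀ ≤ T = τ - c(n) and M ≤ (k-2)z₀ + c(n), as c(n) is a 0-label after s.
      (λ _ → x+w≤t∧c+t≡τ∧m≤w+c⇒x<τ+1-m {τ = τ} (one-label z₀ bs cs p length≡ ones+·≤onesSum b) (last-zero Bn)
               (zero-label-after-s z₀ bs cs (length B) length≡ s<n M≤k-2·z₀+zeros Bn)) ,
      (λ all → ⊥-elim (‼-just-not {B} Bn (AllBetween-∷ʳ-last {B} all p<n)))

    invariant : Invariant z₀ (bs ++ [ true ]) (cs ++ [ u ]) τ
    invariant = record
      { length≡           = trans (length-∷ʳ bs true) (trans (cong suc length≡) (sym (length-∷ʳ cs u)))
      ; nonempty          = subst (1 ≤_) (sym (length-∷ʳ bs true)) (s≤s z≤n)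
      ; z₀<ones           = subst (All (z₀ <ℤ_)) (sym ones′) (All.∷ʳ⁺ z₀<ones z₀<u)
      ; z₀-bound          = z₀-bound
      ; zeros-bound       = subst (All (λ z → z + k-1 · z₀ ≤ℤ τ)) (sym zeros′) zeros-bound
      ; τ<ones+onesSum    = subst₂ (λ O t → All (λ o → τ <ℤ o + t) O) (sym ones′) (sym onesSum′)
                              (All.∷ʳ⁺ (All.map τ<o+u+T₂ z₀<ones) (τ<o+u+T₂ z₀<u))
      ; ones+·≤onesSum    = subst₂ (λ O t → All (λ o → o + k-2 · z₀ ≤ℤ t) O) (sym ones′) (sym onesSum′)
                              (All.∷ʳ⁺ (All.map (λ {o} h → o+m≤τ+1∧w≤t⇒o+w≤τ+1-m+t {o} {τ = τ} h k-2·z₀≤T₂) ones+zerosSum≤τ+1)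
                                       (ℤ.+-monoʳ-≤ u k-2·z₀≤T₂))
      ; ones+zerosSum≤τ+1 = subst₂ (λ O m → All (λ o → o + m ≤ℤ τ + 1ℤ) O) (sym ones′) (sym zerosSum′)
                              (All.∷ʳ⁺ ones+zerosSum≤τ+1 (ℤ.≤-reflexive (τ+1-m+m≡τ+1 τ M)))
      ; last-one          = λ _ → subst₂ (λ c m → c + m ≡ τ + 1ℤ)
                              (sym (labelsOf-∷ʳ-last z₀ bs cs true u length≡)) (sym zerosSum′) (τ+1-m+m≡τ+1 τ M)
      ; last-zero         = λ b → ⊥-elim (‼-just-not {bitsOf (bs ++ [ true ])} (bitsOf-∷ʳ-last bs true) b)
      ; τ<zeros+onesSum   = λ _ → subst₂ (λ Z t → All (λ z → τ <ℤ z + t) Z) (sym zeros′) (sym onesSum′)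
                              (All.map (λ h → m≤w+z∧w≤t⇒τ<z+[τ+1-m+t] {τ = τ} h k-2·z₀≤T₂) M≤k-2·z₀+zeros)
      ; ordered           = subst₂ (λ B′ C′ → Ordered B′ (C′ !_)) (sym (bitsOf-∷ʳ bs true)) (sym (labelsOf-∷ʳ z₀ cs u))
                              (Ordered-∷ʳ true u id id ordered
                                (λ i i≤n → !-∷ʳ C u i (subst (i ≤_) length-B≡length-C i≤n))
                                (subst (λ n → (C ++ [ u ]) ! suc n ≡ u) (sym length-B≡length-C) (!-∷ʳ-last C u))
                                related-to-new)
      }

  module AppendZero {z₀ bs cs τ} (I : Invariant z₀ bs cs τ) where
    open Invariant I

    B : List Bool
    B = bitsOf bs

    C : List ℤ
    C = labelsOf z₀ cs

    ones zeros : List ℤ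
    ones  = labelsWith true bs cs
    zeros = labelsWith false bs cs

    T v τ′ : ℤ
    T  = onesSum z₀ bs cs
    v  = double τ + 1ℤ - double T
    τ′ = double τ + 1ℤ

    cs′ : List ℤ
    cs′ = map double cs ++ [ v ]

    length-bs≡length-2cs : length bs ≡ length (map double cs)
    length-bs≡length-2cs = trans length≡ (sym (List.length-map double cs))

    length-B≡length-2C : length B ≡ length (map double C)
    length-B≡length-2C = trans (length-bitsOf≡length-labelsOf z₀ bs cs length≡) (sym (List.length-map double C))

    ones′ : labelsWith true (bs ++ [ false ]) cs′ ≡ map double ones
    ones′ = trans (labelsWith-∷ʳ true false bs (map double cs) v length-bs≡length-2cs)
              (trans (List.++-identityʳ _) (labelsWith-map true bs cs double))

    zeros′ : labelsWith false (bs ++ [ false ]) cs′ ≡ map double zeros ++ [ v ]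
    zeros′ = trans (labelsWith-∷ʳ false false bs (map double cs) v length-bs≡length-2cs)
               (cong (_++ [ v ]) (labelsWith-map false bs cs double))

    onesSum′ : onesSum (double z₀) (bs ++ [ false ]) cs′ ≡ double T
    onesSum′ = begin
      lastSum k-1 (labelsWith true (bs ++ [ false ]) cs′) (labelsOf (double z₀) cs′)
        ≡⟨ cong₂ (lastSum k-1) ones′ (labelsOf-∷ʳ (double z₀) (map double cs) v) ⟩
      lastSum k-1 (map double ones) (labelsOf (double z₀) (map double cs) ++ [ v ])
        ≡⟨ lastSum-++-pad k-1 (map double ones) _ [ v ]
             (ℕ.≤-trans k-1≤s (s≤length-labelsOf (double z₀) (map double cs))) ⟩
      lastSum k-1 (map double ones) (labelsOf (double z₀) (map double cs))
        ≡⟨ cong (lastSum k-1 (map double ones)) (labelsOf-map-double z₀ cs) ⟨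
      lastSum k-1 (map double ones) (map double C)
        ≡⟨ lastSum-map-double k-1 ones C ⟩
      double T ∎
      where open ≡-Reasoning

    zerosSum′≤ : zerosSum (double z₀) (bs ++ [ false ]) cs′ ≤ℤ double (k-2 · z₀) + v
    zerosSum′≤ =
      subst₂ (λ Z w → sumℤ (take k-1 (sort (replicate s (double z₀) ++ Z))) ≤ℤ w + v)
        (sym zeros′) (·-double k-2 z₀)
        (sumℤ-take-sort-replicate-++-∈ (double z₀) (map double zeros ++ [ v ])
          (ℕ.≤-trans (ℕ.n≤1+n k-2) k-1≤s) (∈-++⁺ʳ (map double zeros) (here refl)))

    k-1·z₀≤T : k-1 · z₀ ≤ℤ T
    k-1·z₀≤T = ·≤lastSum-labelsOf ones cs k-1≤s (All.map ℤ.<⇒≤ z₀<ones)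

    s<n : s < length B
    s<n = s<length-bitsOf bs nonempty

    related-to-new : ∀ {p a} → p ≤ length B → B ‼ p ≡ just a →
      Related (B ++ [ false ]) p (suc (length B)) a false (double (C ! p)) v
    related-to-new {p} {true}  _   b = τ<x+t⇒2τ+1-2t<2x {τ} {C ! p} {T} (one-label z₀ bs cs p length≡ τ<ones+onesSum b)
    related-to-new {p} {false} p≤n b =
      (λ 1+n≤s → ⊥-elim (ℕ.<-irrefl refl (ℕ.<-trans s<n 1+n≤s))) , after-s
      where
      after-s : s < p → (SomeBetween (B ++ [ false ]) true p (suc (length B)) → v <ℤ double (C ! p)) ×
                        (AllBetween (B ++ [ false ]) false p (suc (length B)) → double (C ! p) <ℤ v)
      after-s s<p with ℕ.m≤n⇒m<n∨m≡n p≤n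
      ... | inj₂ refl = ⊥-elim ∘ nothing-between {B ++ [ false ]} , λ _ → c+t≡τ⇒2c<2τ+1-2t {C ! p} {T} (last-zero b)
      ... | inj₁ p<n with ‼-last B (ℕ.≤-trans (s≤s z≤n) s<n)
      ...   | true , Bn =
        (λ _ → τ<x+t⇒2τ+1-2t<2x {τ} {C ! p} {T} (zero-label-after-s z₀ bs cs p length≡ s<p (τ<zeros+onesSum Bn) b)) ,
        (λ all → ⊥-elim (‼-just-not {B} Bn (AllBetween-∷ʳ-last {B} all p<n)))
      ...   | false , Bn =
        (λ some → τ<x+t⇒2τ+1-2t<2x {τ} {C ! p} {T}
           (subst (_<ℤ C ! p + T) (last-zero Bn) (ℤ.+-monoˡ-< T (proj₁ (proj₂ r s<p) (SomeBetween-∷ʳ {B} Bn some))))) ,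
        (λ all → ℤ.<-trans (x<y⇒2x<2y {C ! p} (proj₂ (proj₂ r s<p) (AllBetween-∷ʳ {B} all)))
                           (c+t≡τ⇒2c<2τ+1-2t {C ! length B} {T} (last-zero Bn)))
        where
        r : Related B p (length B) false false (C ! p) (C ! length B)
        r = ordered p<n b Bn

    invariant : Invariant (double z₀) (bs ++ [ false ]) cs′ τ′
    invariant = record
      { length≡           = trans (length-∷ʳ bs false)
                              (trans (cong suc length-bs≡length-2cs) (sym (length-∷ʳ (map double cs) v)))
      ; nonempty          = subst (1 ≤_) (sym (length-∷ʳ bs false)) (s≤s z≤n)
      ; z₀<ones           = subst (All (double z₀ <ℤ_)) (sym ones′) (All.map⁺ (All.map (λ {o} → x<y⇒2x<2y {z₀} {o}) z₀<ones))
      ; z₀-bound          = subst (λ w → double z₀ + w ≤ℤ τ′) (sym (·-double k-1 z₀)) (z+w≤τ⇒2z+2w≤2τ+1 {z₀} {k-1 · z₀} {τ} z₀-bound)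
      ; zeros-bound       = subst₂ (λ Z w → All (λ z → z + w ≤ℤ τ′) Z) (sym zeros′) (sym (·-double k-1 z₀))
                              (All.∷ʳ⁺ (All.map⁺ (All.map (λ {z} → z+w≤τ⇒2z+2w≤2τ+1 {z} {k-1 · z₀} {τ}) zeros-bound))
                                       (w≤t⇒2τ+1-2t+2w≤2τ+1 {τ = τ} k-1·z₀≤T))
      ; τ<ones+onesSum    = subst₂ (λ O t → All (λ o → τ′ <ℤ o + t) O) (sym ones′) (sym onesSum′)
                              (All.map⁺ (All.map (λ {o} → τ<o+t⇒2τ+1<2o+2t {τ} {o} {T}) τ<ones+onesSum))
      ; ones+·≤onesSum    = subst₂ (λ O t → All (λ o → o + k-2 · double z₀ ≤ℤ t) O) (sym ones′) (sym onesSum′)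
                              (subst (λ w → All (λ o → o + w ≤ℤ double T) (map double ones)) (sym (·-double k-2 z₀))
                                (All.map⁺ (All.map (λ {o} → o+w≤t⇒2o+2w≤2t {o} {k-2 · z₀} {T}) ones+·≤onesSum)))
      ; ones+zerosSum≤τ+1 = subst (All (λ o → o + zerosSum (double z₀) (bs ++ [ false ]) cs′ ≤ℤ τ′ + 1ℤ)) (sym ones′)
                              (All.map⁺ (All.map (λ {o} h → o+w≤t∧m≤2w+[2τ+1-2t]⇒2o+m≤2τ+1+1 {o} {k-2 · z₀} {T} {τ = τ} h zerosSum′≤) ones+·≤onesSum))
      ; last-one          = λ b → ⊥-elim (‼-just-not {bitsOf (bs ++ [ false ])} (bitsOf-∷ʳ-last bs false) b)
      ; last-zero         = λ _ → subst₂ (λ c t → c + t ≡ τ′)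
                              (sym (labelsOf-∷ʳ-last (double z₀) bs (map double cs) false v length-bs≡length-2cs))
                              (sym onesSum′) (2τ+1-2t+2t≡2τ+1 τ T)
      ; τ<zeros+onesSum   = λ b → ⊥-elim (‼-just-not {bitsOf (bs ++ [ false ])} (bitsOf-∷ʳ-last bs false) b)
      ; ordered           = subst₂ (λ B′ C′ → Ordered B′ (C′ !_)) (sym (bitsOf-∷ʳ bs false))
                              (trans (cong (_++ [ v ]) (labelsOf-map-double z₀ cs))
                                     (sym (labelsOf-∷ʳ (double z₀) (map double cs) v)))
                              (Ordered-∷ʳ false v double (λ {x} {y} → x<y⇒2x<2y {x} {y}) ordered
                                (λ i i≤n → trans (!-∷ʳ (map double C) v i (subst (i ≤_) length-B≡length-2C i≤n))
                                                 (!-map double refl C i))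
                                (subst (λ n → (map double C ++ [ v ]) ! suc n ≡ v) (sym length-B≡length-2C)
                                  (!-∷ʳ-last (map double C) v))
                                related-to-new)
      }

  module Initial where

    τ₀ : ℤ
    τ₀ = + (2 ℕ.* k)

    B₀ : List Bool
    B₀ = bitsOf [ true ]

    C₀ : List ℤ
    C₀ = labelsOf (+ 2) [ + 3 ]

    length-B₀ : length B₀ ≡ suc s
    length-B₀ = trans (length-replicate-++ s false [ true ]) (ℕ.+-comm s 1)

    B₀-last : B₀ ‼ suc s ≡ just true
    B₀-last = subst (λ i → B₀ ‼ i ≡ just true) (ℕ.+-comm s 1) (‼-replicate-++-shift s false [ true ] 0)

    C₀-last : C₀ ! suc s ≡ + 3
    C₀-last = subst (λ i → C₀ ! i ≡ + 3) (ℕ.+-comm s 1) (cong (fromMaybe 0ℤ) (‼-replicate-++-shift s (+ 2) [ + 3 ] 0))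

    C₀-prefix : ∀ i → 1 ≤ i → i ≤ s → C₀ ! i ≡ + 2
    C₀-prefix i 1≤i i≤s = cong (fromMaybe 0ℤ) (‼-replicate-++ s (+ 2) [ + 3 ] i 1≤i i≤s)

    zerosSum₀ : zerosSum (+ 2) [ true ] [ + 3 ] ≡ k-1 · (+ 2)
    zerosSum₀ = trans (cong (λ L → sumℤ (take k-1 L))
                        (trans (cong sort (List.++-identityʳ (replicate s (+ 2)))) (sort-replicate s (+ 2))))
                      (cong sumℤ (take-replicate k-1 s (+ 2) k-1≤s))

    T₂ : ℤ
    T₂ = lastSum k-2 [] (replicate s (+ 2))

    onesSum₀ : onesSum (+ 2) [ true ] [ + 3 ] ≡ + 3 + T₂
    onesSum₀ = lastSum-∷ʳ k-2 [] (replicate s (+ 2)) (+ 3) (+ 3)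
                 (subst (k-2 ≤_) (sym (List.length-replicate s)) (ℕ.≤-trans (ℕ.n≤1+n k-2) k-1≤s))

    k-2·2≤T₂ : k-2 · (+ 2) ≤ℤ T₂
    k-2·2≤T₂ = ·≤lastSum k-2 [] (replicate s (+ 2))
                 (subst (k-2 ≤_) (sym (List.length-replicate s)) (ℕ.≤-trans (ℕ.n≤1+n k-2) k-1≤s))
                 [] (All.replicate⁺ s ℤ.≤-refl)

    prefix-position : ∀ {i a} → B₀ ‼ i ≡ just a → i ≤ s → a ≡ false × C₀ ! i ≡ + 2
    prefix-position {i} B₀i i≤s =
      sym (just-injective (trans (sym (‼-replicate-++ s false [ true ] i 1≤i i≤s)) B₀i)) , C₀-prefix i 1≤i i≤s
      where
      1≤i : 1 ≤ i
      1≤i = proj₁ (‼-just⇒bounds B₀ i B₀i)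

    last-position : ∀ {i a} → B₀ ‼ i ≡ just a → s < i → i ≡ suc s × a ≡ true
    last-position {i} B₀i s<i with ℕ.≤-antisym (subst (i ≤_) length-B₀ (proj₂ (‼-just⇒bounds B₀ i B₀i))) s<i
    ... | refl = refl , sym (just-injective (trans (sym B₀-last) B₀i))

    ordered₀ : Ordered B₀ (C₀ !_)
    ordered₀ {p} {q} p<q B₀p B₀q with prefix-position B₀p p≤s | ℕ.≤-<-connex q s
      where
      p≤s : p ≤ s
      p≤s = ℕ.≤-pred (ℕ.≤-trans p<q (subst (q ≤_) length-B₀ (proj₂ (‼-just⇒bounds B₀ q B₀q))))
    ... | refl , C₀p | inj₁ q≤s with prefix-position B₀q q≤s
    ...   | refl , C₀q rewrite C₀p | C₀q =
      (λ _ → refl) , (λ s<p → ⊥-elim (ℕ.<-irrefl refl (ℕ.<-trans s<p (ℕ.<-≤-trans p<q q≤s))))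
    ordered₀ {p} {q} p<q B₀p B₀q | refl , C₀p | inj₂ s<q with last-position B₀q s<q
    ...   | refl , refl rewrite C₀p | C₀-last = ℤ.+<+ (s≤s (s≤s (s≤s z≤n)))

    invariant₀ : Invariant (+ 2) [ true ] [ + 3 ] τ₀
    invariant₀ = record
      { length≡           = refl
      ; nonempty          = s≤s z≤n
      ; z₀<ones           = ℤ.+<+ (s≤s (s≤s (s≤s z≤n))) ∷ []
      ; z₀-bound          = subst (λ w → + 2 + w ≤ℤ τ₀) (sym (·-pos k-1 2)) (ℤ.+≤+ (ℕ.≤-reflexive 2+2[k-1]≡2k))
      ; zeros-bound       = []
      ; τ<ones+onesSum    = subst (λ t → τ₀ <ℤ + 3 + t) (sym onesSum₀)
                              (ℤ.<-≤-trans (ℤ.+<+ 2k<6+2[k-2])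
                                (ℤ.+-monoʳ-≤ (+ 3) (ℤ.+-monoʳ-≤ (+ 3) (subst (_≤ℤ T₂) (·-pos k-2 2) k-2·2≤T₂)))) ∷ []
      ; ones+·≤onesSum    = subst (+ 3 + k-2 · (+ 2) ≤ℤ_) (sym onesSum₀) (ℤ.+-monoʳ-≤ (+ 3) k-2·2≤T₂) ∷ []
      ; ones+zerosSum≤τ+1 = ℤ.≤-reflexive 3+zerosSum₀≡τ₀+1 ∷ []
      ; last-one          = λ _ → subst (λ c → c + zerosSum (+ 2) [ true ] [ + 3 ] ≡ τ₀ + 1ℤ)
                                  (sym (trans (cong (C₀ !_) length-B₀) C₀-last)) 3+zerosSum₀≡τ₀+1
      ; last-zero         = λ b → ⊥-elim (‼-just-not {B₀} (trans (cong (B₀ ‼_) length-B₀) B₀-last) b)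
      ; τ<zeros+onesSum   = λ _ → []
      ; ordered           = ordered₀
      }
      where
      2+2[k-1]≡2k : 2 ℕ.+ k-1 ℕ.* 2 ≡ 2 ℕ.* k
      2+2[k-1]≡2k = e k-2
        where e : ∀ m → 2 ℕ.+ suc m ℕ.* 2 ≡ 2 ℕ.* suc (suc m)
              e = ℕ-Solver.solve-∀
      2k<6+2[k-2] : 2 ℕ.* k < 3 ℕ.+ (3 ℕ.+ k-2 ℕ.* 2)
      2k<6+2[k-2] = subst (2 ℕ.* k <_) (e k-2) (ℕ.m<n+m (2 ℕ.* k) {n = 2} (s≤s z≤n))
        where e : ∀ m → 2 ℕ.+ 2 ℕ.* suc (suc m) ≡ 3 ℕ.+ (3 ℕ.+ m ℕ.* 2)
              e = ℕ-Solver.solve-∀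
      3+zerosSum₀≡τ₀+1 : + 3 + zerosSum (+ 2) [ true ] [ + 3 ] ≡ τ₀ + 1ℤ
      3+zerosSum₀≡τ₀+1 = trans (cong (_+_ (+ 3)) (trans zerosSum₀ (·-pos k-1 2))) (cong +_ (e k-2))
        where e : ∀ m → 3 ℕ.+ suc m ℕ.* 2 ≡ 2 ℕ.* suc (suc m) ℕ.+ 1
              e = ℕ-Solver.solve-∀

  record StateInvariant (σ : State) : Set where
    constructor holds
    field
      {z₀} : ℤ
      {bs} : List Bool
      {cs} : List ℤ
      shape     : σ ≡ st (bitsOf bs) (labelsOf z₀ cs) (thr σ)
      invariant : Invariant z₀ bs cs (thr σ)

  step-preserves-invariant : ∀ σ t → StateInvariant σ → StateInvariant (step k σ t)
  step-preserves-invariant (st _ _ τ) true (holds {z₀} {bs} {cs} refl I) =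
    subst StateInvariant (sym (step-true-shape z₀ bs cs τ)) (holds refl (AppendOne.invariant I))
  step-preserves-invariant (st _ _ τ) false (holds {z₀} {bs} {cs} refl I) =
    subst StateInvariant (sym (step-false-shape z₀ bs cs τ)) (holds refl (AppendZero.invariant I))

  foldl-step-preserves-invariant : ∀ xs σ → StateInvariant σ → StateInvariant (foldl (step k) σ xs)
  foldl-step-preserves-invariant []       σ r = r
  foldl-step-preserves-invariant (t ∷ xs) σ r = foldl-step-preserves-invariant xs (step k σ t) (step-preserves-invariant σ t r)

  label≡! : ∀ b i → label k s b i ≡ labels (construct k s b) ! i
  label≡! b i with labels (construct k s b) ‼ i
  ... | just _  = refl
  ... | nothing = refl

  construction-ordered : ∀ b → s < length b → (∀ i → 1 ≤ i → i ≤ s → b ‼ i ≡ just false) →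
    b ‼ suc s ≡ just true → Ordered b (label k s b)
  construction-ordered b s<b zeros one {p} {q} {a} {a′} p<q bp bq
    rewrite label≡! b p | label≡! b q = ordered′ p<q bp bq
    where
    r : StateInvariant (construct k s b)
    r = foldl-step-preserves-invariant (drop (suc s) b) (initial k s b)
          (holds (cong (λ B → st B _ _) (take-suc≡replicate-∷ʳ s b s<b zeros one)) Initial.invariant₀)
    open StateInvariant r
    bits≡b : bitsOf bs ≡ b
    bits≡b = trans (sym (cong bits shape))
               (trans (bits-foldl-step (drop (suc s) b) (initial k s b)) (List.take++drop≡id (suc s) b))
    ordered′ : Ordered b (labels (construct k s b) !_)
    ordered′ = subst₂ (λ B C → Ordered B (C !_)) bits≡b (sym (cong labels shape)) (Invariant.ordered invariant)

lemma4p4 : (k s : ℕ) (b : List Bool) →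
    3 ≤ k → k ∸ 1 ≤ s → s < length b →
    (∀ i → 1 ≤ i → i ≤ s → b ‼ i ≡ just false) → b ‼ suc s ≡ just true →
    -- (1a) labels strictly increase from one 1-interval to a later one
    (∀ i₁ i₂ i₃ i₄ → IsInterval b true i₁ i₂ → IsInterval b true i₃ i₄ → i₂ < i₃ →
      ∀ i j → i₁ ≤ i → i ≤ i₂ → i₃ ≤ j → j ≤ i₄ → label k s b i <ℤ label k s b j)
    -- (1b) labels are constant on a non-trivial 1-interval
    × (∀ i₅ i₆ → IsInterval b true i₅ i₆ → NonTrivial i₅ i₆ →
      ∀ i j → i₅ ≤ i → i ≤ i₆ → i₅ ≤ j → j ≤ i₆ → label k s b i ≡ label k s b j)
    -- (2a) labels are constant on [1,s]
    × (∀ i j → 1 ≤ i → i ≤ s → 1 ≤ j → j ≤ s → label k s b i ≡ label k s b j)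
    -- (2b) labels strictly decrease from one 0-interval (after s) to a later one
    × (∀ i₁ i₂ i₃ i₄ → IsInterval b false i₁ i₂ → IsInterval b false i₃ i₄ →
      s < i₁ → i₂ < i₃ →
      ∀ i j → i₁ ≤ i → i ≤ i₂ → i₃ ≤ j → j ≤ i₄ → label k s b j <ℤ label k s b i)
    -- (2c) labels strictly increase inside a non-trivial 0-interval other than [1,s]
    × (∀ i₅ i₆ → IsInterval b false i₅ i₆ → NonTrivial i₅ i₆ → ¬ (i₅ ≡ 1 × i₆ ≡ s) →
      ∀ i j → i₅ ≤ i → i < j → j ≤ i₆ → label k s b i <ℤ label k s b j)
    -- consequence: every 1-label exceeds every 0-label
    × (∀ i j → b ‼ i ≡ just false → b ‼ j ≡ just true → label k s b i <ℤ label k s b j)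
lemma4p4 1 _ _ (s≤s ())
lemma4p4 (suc (suc k-2)) s b _ k-1≤s s<b zeros one =
    (λ _ _ _ _ int₁ int₂ i₂<i₃ _ _ → increasing-across-1-intervals ord int₁ int₂ i₂<i₃)
  , (λ _ _ int _ _ _ → constant-on-1-interval ord int)
  , (λ _ _ → constant-on-prefix ord zeros)
  , (λ _ _ _ _ int₁ int₂ s<i₁ i₂<i₃ _ _ → decreasing-across-0-intervals ord int₁ int₂ s<i₁ i₂<i₃)
  , (λ _ _ int _ not-prefix _ _ →
       increasing-within-0-interval ord int (0-interval-after-prefix {b} zeros one s<b int not-prefix))
  , (λ _ _ → zero-labels<one-labels ord)
  where
  open Ordering s
  ord : Ordered b (label (suc (suc k-2)) s b)
  ord = Construction.construction-ordered k-2 s k-1≤s b s<b zeros one
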